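{- Fix $d\ge 2$. If $BT_d(h,k)\in\mathbf{L}$ (resp. $\in\mathbf{NL}$), then there are a constant $c_d$ and a function $f_d$ such that $\#\mathrm{detFstates}^h_d(k)\le f_d(h)k^{c_d}$ (resp. $\#\mathrm{ndetFstates}^h_d(k)\le f_d(h)k^{c_d}$) for all $h,k\ge 2$.
   Context: $T^h_d$ is the balanced rooted $d$-ary tree with $h$ levels. An instance with parameter $k$ assigns to each internal node $i$ a function $f_i:[k]^d\to[k]$ (given by its $k^d$ values) and to each leaf an element of $[k]=\{1,\dots,k\}$; $v_i$ is the leaf label for a leaf and $v_i=f_i(v_{j_1},\dots,v_{j_d})$ for an internal node with children $j_1,\dots,j_d$. $FT^h_d(k)$: output the root value; its $k$-ary input variables are $f_i(x)$ (internal $i$, $x\in[k]^d$) and one per leaf. $BT_d(h,k)$ is the language of binary strings encoding $h,k$, all node functions (as $k^d$ binary numbers each) and leaf values, whose root value is $1$. A nondeterministic $k$-way branching program computing $g:[k]^m\to R$ is a directed rooted multigraph of states, edges labelled by elements of $[k]$, nonfinal states labelled by variable indices in $[m]$, and $|R|$ final sink states labelled by elements of $R$; on input $x$, edges labelled $x_j$ out of states labelled $j$ are activated; each computation (path of activated edges from the root) is infinite, ends in the final state labelled $g(x)$, or aborts at a state labelled $j$ with no outedge labelled $x_j$, and at least one ends in a final state. It is deterministic if every nonfinal state has exactly $k$ outedges labelled $1,\dots,k$. $\#\mathrm{detFstates}^h_d(k)$ (resp. $\#\mathrm{ndetFstates}^h_d(k)$) is the minimum number of states of a deterministic (resp. nondeterministic)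 $k$-way branching program computing $FT^h_d(k)$. -}

module Defs where

open import Data.Nat using (ℕ; zero; suc; _+_; _*_; _≤_; _^_; pred; _⊓_; _/_; _%_; _≡ᵇ_)
open import Data.Nat.Logarithm using (⌊log₂_⌋)
open import Data.Fin using (Fin; toℕ)
open import Data.Bool using (Bool; true; false; if_then_else_)
open import Data.Maybe using (Maybe; just; nothing)
open import Data.List using (List; []; _∷_; [_]; _++_; map; concatMap; allFin; length)
open import Data.List.Membership.Propositional using (_∈_)
open import Data.Vec using (Vec; tabulate) renaming ([] to []ᵛ; _∷_ to _∷ᵛ_)
open import Data.Unit using (⊤; tt)
open import Data.Empty using (⊥)
open import Data.Sum using (_⊎_; inj₁; inj₂)
open import Data.Product using (Σ; _×_; _,_)
open import Relation.Binary.PropositionalEquality using (_≡_)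
open import Relation.Binary.Construct.Closure.ReflexiveTransitive using (Star)

-- We index by n = h - 1 (number of levels
-- of internal nodes); T^h_d has h = n + 1 levels.
-- Var d k n : the input variables of FT^{n+1}_d(k):
--   n = 0 : the single leaf;
--   n+1   : the root's function values f_root(x), x ∈ [k]^d  (inj₁ x),
--           or a variable of the j-th subtree (inj₂ (j , v)).
-- The value 1 ∈ [k] is represented by (zero : Fin k), i.e. [k] = Fin k.

Var : ℕ → ℕ → ℕ → Set
Var d k zero    = ⊤
Var d k (suc n) = Vec (Fin k) d ⊎ (Fin d × Var d k n)

eval : ∀ d k n → (Var d k n → Fin k) → Fin k
eval d k zero    x = x tt
eval d k (suc n) x =
  x (inj₁ (tabulate (λ j → eval d k n (λ v → x (inj₂ (j , v))))))

record BP (V : Set) (k : ℕ) (R : Set) : Set where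
  field
    n     : ℕ
    root  : Fin n
    label : Fin n → V ⊎ R          -- inj₁ v : nonfinal, queries v ; inj₂ r : final, labelled r
    e     : ℕ                      -- number of edges (multigraph)
    src   : Fin e → Fin n
    tgt   : Fin e → Fin n
    elab  : Fin e → Fin k
    sink  : ∀ i r → label (src i) ≡ inj₂ r → ⊥
    final : ∀ r → Σ (Fin n) λ s → label s ≡ inj₂ r × (∀ s' → label s' ≡ inj₂ r → s' ≡ s)

module _ {V : Set} {k : ℕ} {R : Set} (P : BP V k R) where
  open BP P

  Active : (V → Fin k) → Fin n → Fin n → Set
  Active x s t = Σ (Fin e) λ i → src i ≡ s × tgt i ≡ t
                   × Σ V (λ v → label s ≡ inj₁ v × elab i ≡ x v)

  Reach : (V → Fin k) → Fin n → Set
  Reach x s = Star (Active x) root s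

  IsDeterministic : Set
  IsDeterministic = ∀ s v → label s ≡ inj₁ v → ∀ (a : Fin k) →
    Σ (Fin e) λ i → (src i ≡ s × elab i ≡ a)
                    × (∀ j → src j ≡ s → elab j ≡ a → j ≡ i)

  -- some computation ends in the final state labelled g x, and no
  -- computation ends in another final state (others are infinite or abort)
  Computes : ((V → Fin k) → R) → Set
  Computes g = ∀ x →
    Σ (Fin n) (λ s → Reach x s × label s ≡ inj₂ (g x))
    × (∀ s r → Reach x s → label s ≡ inj₂ r → r ≡ g x)

DetFStatesLe : (d h k N : ℕ) → Set
DetFStatesLe d h k N = Σ (BP (Var d k (pred h)) k (Fin k)) λ P →
  IsDeterministic P × Computes P (eval d k (pred h)) × BP.n P ≤ N

NdetFStatesLe : (d h k N : ℕ) → Set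
NdetFStatesLe d h k N = Σ (BP (Var d k (pred h)) k (Fin k)) λ P →
  Computes P (eval d k (pred h)) × BP.n P ≤ N

-- Encoding of BT_d(h,k) as binary strings.
-- A natural number m is written in binary (most significant bit first,
-- 0 written as the empty digit string), every bit doubled, followed by 01.

bitsAux : ℕ → ℕ → List Bool
bitsAux zero    m = []
bitsAux (suc f) zero = []
bitsAux (suc f) m@(suc _) = bitsAux f (m / 2) ++ [ m % 2 ≡ᵇ 1 ]

bits : ℕ → List Bool
bits m = bitsAux m m

encNum : ℕ → List Bool
encNum m = concatMap (λ b → b ∷ b ∷ []) (bits m) ++ (false ∷ true ∷ [])

allVecs : ∀ k d → List (Vec (Fin k) d)
allVecs k zero    = []ᵛ ∷ []
allVecs k (suc d) = concatMap (λ a → map (a ∷ᵛ_) (allVecs k d)) (allFin k)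

enum : ∀ d k n → List (Var d k n)
enum d k zero    = tt ∷ []
enum d k (suc n) = map inj₁ (allVecs k d)
  ++ concatMap (λ j → map (λ v → inj₂ (j , v)) (enum d k n)) (allFin d)

-- encoding of h = n+1, k, then all node functions and leaf values
-- (values in [k] written as numbers 1..k)
encode : ∀ d n k → (Var d k n → Fin k) → List Bool
encode d n k x = encNum (suc n) ++ encNum k
  ++ concatMap (λ v → encNum (suc (toℕ (x v)))) (enum d k n)

BT : ℕ → List Bool → Set
BT d w = Σ ℕ λ n → Σ ℕ λ k' → Σ (Var d (suc k') n → Fin (suc k')) λ x →
  w ≡ encode d n (suc k') x × eval d (suc k') n x ≡ Fin.zero
  where import Data.Fin as Fin

-- Turing machines with a read-only input tape (with endmarkers) and one
-- work tape; possibly nondeterministic.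

data Move : Set where
  left stay right : Move

record TM : Set where
  field
    Q G   : ℕ                         -- states Fin Q; work alphabet Fin (suc G), zero = blank
    start : Fin Q
    acc   : Fin Q
    -- input symbol: just b, or nothing for an endmarker
    δ     : Fin Q → Maybe Bool → Fin (suc G)
            → List (Fin Q × Fin (suc G) × Move × Move)  -- new state, written symbol, input move, work move

module _ (M : TM) where
  open TM M

  record Config : Set where
    constructor cfg
    field
      state : Fin Q
      ipos  : ℕ                  -- 0 and |w|+1 are the endmarkers
      wtape : ℕ → Fin (suc G)
      wpos  : ℕ

  inputAt : List Bool → ℕ → Maybe Bool
  inputAt w zero = nothing
  inputAt [] (suc i) = nothing
  inputAt (b ∷ w) (suc zero) = just b
  inputAt (b ∷ w) (suc (suc i)) = inputAt w (suc i)

  moveI : ℕ → Move → ℕ → ℕ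
  moveI len left  i = pred i
  moveI len stay  i = i
  moveI len right i = suc i ⊓ suc len

  moveW : Move → ℕ → ℕ
  moveW left  i = pred i
  moveW stay  i = i
  moveW right i = suc i

  write : (ℕ → Fin (suc G)) → ℕ → Fin (suc G) → ℕ → Fin (suc G)
  write t p a j = if j ≡ᵇ p then a else t j

  next : List Bool → Config → Fin Q × Fin (suc G) × Move × Move → Config
  next w (cfg q i t p) (q' , a , mi , mw) =
    cfg q' (moveI (length w) mi i) (write t p a) (moveW mw p)

  data Step (w : List Bool) : Config → Config → Set where
    step : ∀ {c} tr → tr ∈ δ (Config.state c) (inputAt w (Config.ipos c))
                              (Config.wtape c (Config.wpos c))
           → Step w c (next w c tr)

  initial : Config
  initial = cfg start zero (λ _ → Fin.zero) zero
    where import Data.Fin as Fin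

  Reachable : List Bool → Config → Set
  Reachable w c = Star (Step w) initial c

  Accepts : List Bool → Set
  Accepts w = Σ Config λ c → Reachable w c × Config.state c ≡ acc

  IsDetTM : Set
  IsDetTM = ∀ q a g → length (δ q a g) ≤ 1

  LogSpace : Set
  LogSpace = Σ ℕ λ c → ∀ w conf → Reachable w conf →
    Config.wpos conf ≤ c * suc ⌊log₂ length w ⌋

  Decides : (List Bool → Set) → Set
  Decides P = ∀ w → (P w → Accepts w) × (Accepts w → P w)

InL : (List Bool → Set) → Set
InL P = Σ TM λ M → IsDetTM M × LogSpace M × Decides M P

InNL : (List Bool → Set) → Set
InNL P = Σ TM λ M → LogSpace M × Decides M P

module Submission where

open import Defs
open import Data.Nat using (ℕ; zero; suc; _+_; _*_; _∸_; _≤_; _<_; _^_; z≤n; s≤s; pred; >-nonZero; _⊓_; _≡ᵇ_; _<?_; _/_; _%_; ⌊_/2⌋)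
open import Data.Nat.Properties hiding (_≟_)
open import Data.Nat.DivMod using (m≡m%n+[m/n]*n; m%n<n; m/n<m)
open import Data.Nat.Logarithm using (⌊log₂_⌋; ⌊log₂⌋-mono-≤)
open import Data.Nat.Logarithm.Core using (⌊log2⌋)
open import Data.Nat.Tactic.RingSolver using (solve-∀)
open import Induction.WellFounded as WF using (Acc)
open import Data.Fin as F using (Fin; toℕ; _≟_; fromℕ<; inject₁; fromℕ; _↑ˡ_; _↑ʳ_; splitAt; join; combine; remQuot)
open import Data.Fin.Properties using (splitAt-↑ˡ; splitAt-↑ʳ; join-splitAt; remQuot-combine; combine-remQuot; ↑ˡ-injective; toℕ-fromℕ<; fromℕ<-toℕ; toℕ-inject₁; toℕ-fromℕ; toℕ<n; toℕ≤pred[n]; toℕ-injective; pigeonhole)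
open import Data.List using (List; []; _∷_; [_]; length; _++_; map; concatMap; allFin; mapMaybe)
open import Data.List.Properties using (length-++; length-map; length-tabulate; length-mapMaybe; ++-assoc)
open import Data.List.Membership.Propositional using (_∈_; lose)
open import Data.List.Membership.Propositional.Properties using (∈-allFin; ∈-map⁺; ∈-map⁻; ∈-++⁺ˡ; ∈-++⁺ʳ; ∈-++⁻; ∈-concatMap⁺)
open import Data.List.Relation.Unary.Any using (here; there; index)
open import Data.Vec using (Vec; lookup; replicate; _[_]≔_) renaming ([] to []ᵛ; _∷_ to _∷ᵛ_)
open import Data.Vec.Properties using (tabulate-cong)
open import Data.Maybe using (Maybe; just; nothing; _>>=_)
open import Data.Bool using (Bool; true; false; if_then_else_)
open import Data.Unit using (⊤; tt)
open import Data.Empty using (⊥; ⊥-elim)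
open import Data.Sum using (_⊎_; inj₁; inj₂; [_,_]′)
open import Data.Product using (Σ; _×_; _,_; proj₁; proj₂)
open import Relation.Nullary using (yes; no; ¬_; Dec)
open import Relation.Binary.PropositionalEquality hiding ([_])
open import Relation.Binary.Construct.Closure.ReflexiveTransitive using (Star; ε; _◅_; _◅◅_; gmap)

-- A log-space machine M for BT_d runs
-- on the encoding of an instance of FT^h_d(k), a word of length polynomial in
-- k (for fixed h) made of segments each of which depends on ONE input variable.
-- A configuration of M, with the input-head position replaced by (segment,
-- offset), ranges over a set of size f(h)·k^c; such a "core" configuration
-- determines the variable a branching program must query to know the next
-- input symbol.  To output the root value instead of deciding "root = 1" we
-- run M on the instance whose root function has the values r and 1 swapped.
--   * nondeterministic: guess r, then simulate M; output r when M accepts;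
--   * deterministic: try r = 1, 2, …, simulating M with a step counter that
--     bounds the run by the number of core configurations (pigeonhole).

lookupOr : ∀ {X : Set} → List X → ℕ → X → X
lookupOr [] i d = d
lookupOr (x ∷ l) zero d = x
lookupOr (x ∷ l) (suc i) d = lookupOr l i d

lookupOr-index : ∀ {X : Set} {x : X} {l} (p : x ∈ l) d → lookupOr l (toℕ (index p)) d ≡ x
lookupOr-index (here refl) d = refl
lookupOr-index (there p) d = lookupOr-index p d

lookupOr-∈ : ∀ {X : Set} (l : List X) i d → lookupOr l i d ∈ l ⊎ lookupOr l i d ≡ d
lookupOr-∈ [] i d = inj₂ refl
lookupOr-∈ (x ∷ l) zero d = inj₁ (here refl)
lookupOr-∈ (x ∷ l) (suc i) d with lookupOr-∈ l i d
... | inj₁ p = inj₁ (there p)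
... | inj₂ q = inj₂ q

index<length : ∀ {X : Set} {x : X} {l} (p : x ∈ l) → toℕ (index p) < length l
index<length (here _) = s≤s z≤n
index<length (there p) = s≤s (index<length p)

lookupM : ∀ {A : Set} → List A → ℕ → Maybe A
lookupM [] i = nothing
lookupM (x ∷ l) zero = just x
lookupM (x ∷ l) (suc i) = lookupM l i

lookupM-++ˡ : ∀ {A : Set} (l1 l2 : List A) i → i < length l1 → lookupM (l1 ++ l2) i ≡ lookupM l1 i
lookupM-++ˡ (x ∷ l1) l2 zero p = refl
lookupM-++ˡ (x ∷ l1) l2 (suc i) (s≤s p) = lookupM-++ˡ l1 l2 i p

lookupM-++ʳ : ∀ {A : Set} (l1 l2 : List A) i → lookupM (l1 ++ l2) (length l1 + i) ≡ lookupM l2 i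
lookupM-++ʳ [] l2 i = refl
lookupM-++ʳ (x ∷ l1) l2 i = lookupM-++ʳ l1 l2 i

lookupM-length : ∀ {A : Set} (l : List A) → lookupM l (length l) ≡ nothing
lookupM-length [] = refl
lookupM-length (x ∷ l) = lookupM-length l

mapMaybe-∈⁻ : ∀ {A B : Set} (f : A → Maybe B) (xs : List A) {y} → y ∈ mapMaybe f xs → Σ A λ x → x ∈ xs × f x ≡ just y
mapMaybe-∈⁻ f (x ∷ xs) p with f x in e
mapMaybe-∈⁻ f (x ∷ xs) (here refl) | just y = x , here refl , e
mapMaybe-∈⁻ f (x ∷ xs) (there p) | just y with mapMaybe-∈⁻ f xs p
... | z , q , r = z , there q , r
mapMaybe-∈⁻ f (x ∷ xs) p | nothing with mapMaybe-∈⁻ f xs p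
... | z , q , r = z , there q , r

mapMaybe-∈⁺ : ∀ {A B : Set} (f : A → Maybe B) {xs : List A} {x y} → x ∈ xs → f x ≡ just y → y ∈ mapMaybe f xs
mapMaybe-∈⁺ f {x ∷ xs} (here refl) e with f x
mapMaybe-∈⁺ f {x ∷ xs} (here refl) refl | just _ = here refl
mapMaybe-∈⁺ f {x ∷ xs} (there p) e with f x
... | just _ = there (mapMaybe-∈⁺ f p e)
... | nothing = mapMaybe-∈⁺ f p e

headM : ∀ {A : Set} → List A → Maybe A
headM [] = nothing
headM (x ∷ _) = just x

headM-∈ : ∀ {A : Set} (l : List A) {y} → length l ≤ 1 → y ∈ l → headM l ≡ just y
headM-∈ (x ∷ []) _ (here refl) = refl
headM-∈ (x ∷ []) _ (there ())
headM-∈ (x ∷ _ ∷ _) (s≤s ()) _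

∈-headM : ∀ {A : Set} (l : List A) {y} → headM l ≡ just y → y ∈ l
∈-headM (x ∷ l) refl = here refl

cong₃ : ∀ {A B C D : Set} (f : A → B → C → D) {a a' b b' c c'} → a ≡ a' → b ≡ b' → c ≡ c' → f a b c ≡ f a' b' c'
cong₃ f refl refl refl = refl

_▷_ : ∀ {A : Set} {R : A → A → Set} {s t u} → Star R s t → R t u → Star R s u
p ▷ r = p ◅◅ (r ◅ ε)

star-ind : ∀ {A : Set} {R : A → A → Set} {s0} (Pr : A → Set) → Pr s0 →
  (∀ {s t} → Star R s0 s → Pr s → R s t → Pr t) → ∀ {t} → Star R s0 t → Pr t
star-ind {A} {R} {s0} Pr p0 stp = go ε p0
  where
  go : ∀ {s t} → Star R s0 s → Pr s → Star R s t → Pr t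
  go pre p ε = p
  go pre p (r ◅ rs) = go (pre ▷ r) (stp pre p r) rs

finSum : (n : ℕ) → (Fin n → ℕ) → ℕ
finSum zero f = 0
finSum (suc n) f = f F.zero + finSum n (λ i → f (F.suc i))

≤finSum : ∀ n f i → f i ≤ finSum n f
≤finSum (suc n) f F.zero = m≤m+n _ _
≤finSum (suc n) f (F.suc i) = ≤-trans (≤finSum n (λ i → f (F.suc i)) i) (m≤n+m _ _)

-- Finite state sets.  A FinEnc of A embeds A into Fin size with a left
-- inverse; the size is what the state count of a branching program measures.

record FinEnc (A : Set) : Set where
  field
    size : ℕ
    enc : A → Fin size
    dec : Fin size → A
    dec-enc : ∀ a → dec (enc a) ≡ a
open FinEnc public

finE : ∀ n → FinEnc (Fin n)
finE n = record { size = n ; enc = λ i → i ; dec = λ i → i ; dec-enc = λ _ → refl }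

⊤E : FinEnc ⊤
⊤E = record { size = 1 ; enc = λ _ → F.zero ; dec = λ _ → tt ; dec-enc = λ _ → refl }

_×E_ : ∀ {A B} → FinEnc A → FinEnc B → FinEnc (A × B)
_×E_ {A} {B} EA EB = record { size = size EA * size EB
  ; enc = λ { (a , b) → combine (enc EA a) (enc EB b) }
  ; dec = λ i → dec EA (proj₁ (remQuot {size EA} (size EB) i)) , dec EB (proj₂ (remQuot {size EA} (size EB) i))
  ; dec-enc = λ { (a , b) → cong₂ _,_ (lemma₁ a b) (lemma₂ a b) } }
  where
  decode : A → B → Fin (size EA) × Fin (size EB)
  decode a b = remQuot {size EA} (size EB) (combine (enc EA a) (enc EB b))
  lemma₁ : ∀ a b → dec EA (proj₁ (decode a b)) ≡ a
  lemma₁ a b = trans (cong (λ p → dec EA (proj₁ p)) (remQuot-combine (enc EA a) (enc EB b))) (dec-enc EA a)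
  lemma₂ : ∀ a b → dec EB (proj₂ (decode a b)) ≡ b
  lemma₂ a b = trans (cong (λ p → dec EB (proj₂ p)) (remQuot-combine (enc EA a) (enc EB b))) (dec-enc EB b)

_⊎E_ : ∀ {A B} → FinEnc A → FinEnc B → FinEnc (A ⊎ B)
EA ⊎E EB = record { size = size EA + size EB
  ; enc = [ (λ a → enc EA a ↑ˡ size EB) , (λ b → size EA ↑ʳ enc EB b) ]′
  ; dec = λ i → [ (λ a → inj₁ (dec EA a)) , (λ b → inj₂ (dec EB b)) ]′ (splitAt (size EA) i)
  ; dec-enc = lemma }
  where
  lemma : ∀ x → [ (λ a → inj₁ (dec EA a)) , (λ b → inj₂ (dec EB b)) ]′
                  (splitAt (size EA) ([ (λ a → enc EA a ↑ˡ size EB) , (λ b → size EA ↑ʳ enc EB b) ]′ x)) ≡ x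
  lemma (inj₁ a) rewrite splitAt-↑ˡ (size EA) (enc EA a) (size EB) | dec-enc EA a = refl
  lemma (inj₂ b) rewrite splitAt-↑ʳ (size EA) (size EB) (enc EB b) | dec-enc EB b = refl

vecE : ∀ {A} → FinEnc A → ∀ n → FinEnc (Vec A n)
vecE EA zero = record { size = 1 ; enc = λ _ → F.zero ; dec = λ _ → []ᵛ ; dec-enc = λ { []ᵛ → refl } }
vecE {A} EA (suc n) = record { size = size P ; enc = λ { (a ∷ᵛ v) → enc P (a , v) }
  ; dec = λ i → proj₁ (dec P i) ∷ᵛ proj₂ (dec P i)
  ; dec-enc = λ { (a ∷ᵛ v) → cong₂ _∷ᵛ_ (cong proj₁ (dec-enc P (a , v))) (cong proj₂ (dec-enc P (a , v))) } }
  where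
  P : FinEnc (A × Vec A n)
  P = EA ×E vecE EA n

size-vecE : ∀ {A : Set} (E : FinEnc A) m → size (vecE E m) ≡ size E ^ m
size-vecE E zero = refl
size-vecE E (suc m) = cong (size E *_) (size-vecE E m)

retractE : ∀ {A B : Set} → FinEnc A → (f : B → A) (g : A → B) → (∀ b → g (f b) ≡ b) → FinEnc B
retractE EA f g gf = record { size = size EA ; enc = λ b → enc EA (f b) ; dec = λ i → g (dec EA i)
  ; dec-enc = λ b → trans (cong g (dec-enc EA (f b))) (gf b) }

maybeE : ∀ {A : Set} → FinEnc A → FinEnc (Maybe A)
maybeE {A} EA = retractE (⊤E ⊎E EA) f g gf
  where
  f : Maybe A → ⊤ ⊎ A
  f nothing = inj₁ tt
  f (just a) = inj₂ a
  g : ⊤ ⊎ A → Maybe A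
  g (inj₁ _) = nothing
  g (inj₂ a) = just a
  gf : ∀ m → g (f m) ≡ m
  gf nothing = refl
  gf (just a) = refl

-- If b is an iterate of a, then by pigeonhole it
-- is already one of the first size+1 iterates, for any finite encoding of
-- Maybe A: two of those coincide and the run in between can be cut out.
module Iteration {A : Set} (F : A → Maybe A) where
  iterate : A → ℕ → Maybe A
  iterate a zero = just a
  iterate a (suc N) = F a >>= λ b → iterate b N

  iterate-+ : ∀ a M N → iterate a (M + N) ≡ (iterate a M >>= λ b → iterate b N)
  iterate-+ a zero N = refl
  iterate-+ a (suc M) N with F a
  ... | nothing = refl
  ... | just b = iterate-+ b M N

  iterate-suc : ∀ a N → iterate a (suc N) ≡ (iterate a N >>= F)
  iterate-suc a N = trans (cong (iterate a) (+-comm 1 N)) (trans (iterate-+ a N 1) (lastStep (iterate a N)))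
    where
    lastStep : ∀ m → (m >>= λ b → F b >>= just) ≡ (m >>= F)
    lastStep nothing = refl
    lastStep (just b) with F b
    ... | nothing = refl
    ... | just _ = refl

  iterate-nothing : ∀ a M L → iterate a M ≡ nothing → iterate a (M + L) ≡ nothing
  iterate-nothing a M L e = trans (iterate-+ a M L) (cong (λ m → m >>= λ b → iterate b L) e)

  path-iterate : ∀ {R : A → A → Set} → (∀ {b c} → R b c → F b ≡ just c) →
    ∀ {a b} → Star R a b → Σ ℕ λ N → iterate a N ≡ just b
  path-iterate F-step ε = 0 , refl
  path-iterate F-step {a} (r ◅ rs) with path-iterate F-step rs
  ... | N , e = suc N , trans (cong (λ m → m >>= λ b → iterate b N) (F-step r)) e

  shorten : (E : FinEnc (Maybe A)) → ∀ a {b} N → iterate a N ≡ just b →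
    Σ ℕ λ N' → N' < suc (size E) × iterate a N' ≡ just b
  shorten E a {b} N = go (suc N) N ≤-refl
    where
    go : ∀ fuel N → N < fuel → iterate a N ≡ just b → Σ ℕ λ N' → N' < suc (size E) × iterate a N' ≡ just b
    go (suc fuel) N (s≤s N≤fuel) e with N <? suc (size E)
    ... | yes small = N , small , e
    ... | no large with pigeonhole (n<1+n (size E)) (λ i → enc E (iterate a (toℕ i)))
    ...   | i , j , i<j , same = go fuel (toℕ i + rest) (≤-trans shorter N≤fuel) cut
      where
      rest : ℕ
      rest = N ∸ toℕ j
      N≡ : toℕ j + rest ≡ N
      N≡ = m+[n∸m]≡n (≤-trans (<⇒≤ (toℕ<n j)) (≮⇒≥ large))
      same-iterate : iterate a (toℕ i) ≡ iterate a (toℕ j)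
      same-iterate = trans (sym (dec-enc E _)) (trans (cong (dec E) same) (dec-enc E _))
      cut : iterate a (toℕ i + rest) ≡ just b
      cut = begin
        iterate a (toℕ i + rest)                         ≡⟨ iterate-+ a (toℕ i) rest ⟩
        (iterate a (toℕ i) >>= λ c → iterate c rest)     ≡⟨ cong (λ m → m >>= λ c → iterate c rest) same-iterate ⟩
        (iterate a (toℕ j) >>= λ c → iterate c rest)     ≡⟨ sym (iterate-+ a (toℕ j) rest) ⟩
        iterate a (toℕ j + rest)                         ≡⟨ cong (iterate a) N≡ ⟩
        iterate a N                                      ≡⟨ e ⟩
        just b                                           ∎
        where open ≡-Reasoning
      shorter : toℕ i + rest < N
      shorter = subst (toℕ i + rest <_) N≡ (+-monoˡ-< rest i<j)

-- A k-way program over the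
-- variables V has a finite state set S, a start state σ0, a query qry σ for
-- every state, and for every state and answer a list of at most B successors
-- (a state, or an output in Fin k).  The branching program has the states of
-- S plus one final state per output; the edge number (σ, a, b) follows the
-- b-th successor of σ on answer a, and padding edges lead to the state dead.
module ProgramBP {V : Set} (k : ℕ) {S : Set} (E : FinEnc S) (B : ℕ)
  (qry : S → V) (step : S → Fin k → List (S ⊎ Fin k)) (dead : S) (σ0 : S) where

  m : ℕ
  m = size E

  successor : S → Fin k → Fin B → S ⊎ Fin k
  successor σ a b = lookupOr (step σ a) (toℕ b) (inj₁ dead)

  embed : S ⊎ Fin k → Fin (m + k)
  embed (inj₁ σ) = enc E σ ↑ˡ k
  embed (inj₂ r) = m ↑ʳ r

  label : Fin (m + k) → V ⊎ Fin k
  label s = [ (λ i → inj₁ (qry (dec E i))) , inj₂ ]′ (splitAt m s)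

  label-↑ˡ : ∀ i → label (i ↑ˡ k) ≡ inj₁ (qry (dec E i))
  label-↑ˡ i rewrite splitAt-↑ˡ m i k = refl

  label-↑ʳ : ∀ r → label (m ↑ʳ r) ≡ inj₂ r
  label-↑ʳ r rewrite splitAt-↑ʳ m k r = refl

  label-final : ∀ s r → label s ≡ inj₂ r → s ≡ m ↑ʳ r
  label-final s r eq with splitAt m s in e
  label-final s r () | inj₁ i
  label-final s r refl | inj₂ r' = trans (sym (join-splitAt m k s)) (cong (join m k) e)

  edge : Fin m → Fin k → Fin B → Fin (m * k * B)
  edge i a b = combine (combine i a) b

  edgeSource : Fin (m * k * B) → Fin m
  edgeSource j = proj₁ (remQuot {m} k (proj₁ (remQuot {m * k} B j)))

  edgeAnswer : Fin (m * k * B) → Fin k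
  edgeAnswer j = proj₂ (remQuot {m} k (proj₁ (remQuot {m * k} B j)))

  edgeChoice : Fin (m * k * B) → Fin B
  edgeChoice j = proj₂ (remQuot {m * k} B j)

  edge-decode : ∀ i a b → edgeSource (edge i a b) ≡ i × edgeAnswer (edge i a b) ≡ a × edgeChoice (edge i a b) ≡ b
  edge-decode i a b = cong proj₁ inner , cong proj₂ inner , cong proj₂ outer
    where
    outer : remQuot {m * k} B (edge i a b) ≡ (combine i a , b)
    outer = remQuot-combine {m * k} {B} (combine i a) b
    inner : remQuot {m} k (proj₁ (remQuot {m * k} B (edge i a b))) ≡ (i , a)
    inner = trans (cong (λ p → remQuot {m} k (proj₁ p)) outer) (remQuot-combine i a)

  edge-encode : ∀ j → edge (edgeSource j) (edgeAnswer j) (edgeChoice j) ≡ j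
  edge-encode j = trans (cong (λ p → combine p (edgeChoice j)) (combine-remQuot {m} k (proj₁ (remQuot {m * k} B j))))
                        (combine-remQuot {m * k} B j)

  bp : BP V k (Fin k)
  bp = record
    { n = m + k ; root = enc E σ0 ↑ˡ k ; label = label ; e = m * k * B
    ; src = λ j → edgeSource j ↑ˡ k
    ; tgt = λ j → embed (successor (dec E (edgeSource j)) (edgeAnswer j) (edgeChoice j))
    ; elab = edgeAnswer
    ; sink = λ j r eq → case-inj (trans (sym (label-↑ˡ (edgeSource j))) eq)
    ; final = λ r → m ↑ʳ r , label-↑ʳ r , λ s' eq → label-final s' r eq }
    where
    case-inj : ∀ {v : V} {r : Fin k} → inj₁ v ≡ inj₂ r → ⊥
    case-inj ()

  -- one step of the program on input x; padding edges may also lead to dead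
  SimStep : (V → Fin k) → S → S ⊎ Fin k → Set
  SimStep x σ τ = τ ∈ step σ (x (qry σ)) ⊎ τ ≡ inj₁ dead

  edge-sound : ∀ x s t → Active bp x s t → Σ (Fin m) λ i → s ≡ i ↑ˡ k ×
                 Σ (S ⊎ Fin k) λ τ → t ≡ embed τ × SimStep x (dec E i) τ
  edge-sound x s t (j , refl , refl , v , lv , ej) =
    edgeSource j , refl , successor (dec E (edgeSource j)) (edgeAnswer j) (edgeChoice j) , refl ,
    answered (trans ej (cong x (sym queried)))
    where
    queried : qry (dec E (edgeSource j)) ≡ v
    queried with trans (sym (label-↑ˡ (edgeSource j))) lv
    ... | refl = refl
    answered : ∀ {σ a b} → a ≡ x (qry σ) → SimStep x σ (successor σ a b)
    answered refl = lookupOr-∈ _ _ _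

  record OutputInvariant (x : V → Fin k) (g : Fin k) : Set₁ where
    field
      Inv : S → Set
      inv-start : Inv σ0
      inv-step : ∀ {σ τ} → Inv σ → SimStep x σ (inj₁ τ) → Inv τ
      inv-out : ∀ {σ r} → Inv σ → SimStep x σ (inj₂ r) → r ≡ g

  module Soundness (x : V → Fin k) (g : Fin k) (I : OutputInvariant x g) where
    open OutputInvariant I

    Good : Fin (m + k) → Set
    Good t = (Σ (Fin m) λ i → t ≡ i ↑ˡ k × Inv (dec E i)) ⊎ (Σ (Fin k) λ r → t ≡ m ↑ʳ r × r ≡ g)

    Good-step : ∀ {s t} → Good s → Active bp x s t → Good t
    Good-step {s} {t} gs act with edge-sound x s t act
    ... | i , refl , τ , refl , st with gs
    ... | inj₂ (r , e1 , _) with trans (sym (label-↑ˡ i)) (trans (cong label e1) (label-↑ʳ r))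
    ...    | ()
    Good-step gs act | i , refl , inj₁ σ' , refl , st | inj₁ (i' , e1 , iv) with ↑ˡ-injective k i i' e1
    ... | refl = inj₁ (enc E σ' , refl , subst Inv (sym (dec-enc E σ')) (inv-step iv st))
    Good-step gs act | i , refl , inj₂ r , refl , st | inj₁ (i' , e1 , iv) with ↑ˡ-injective k i i' e1
    ... | refl = inj₂ (r , refl , inv-out iv st)

    sound : ∀ s r → Reach bp x s → label s ≡ inj₂ r → r ≡ g
    sound s r rs ls with star-ind Good (inj₁ (enc E σ0 , refl , subst Inv (sym (dec-enc E σ0)) inv-start))
                           (λ _ → Good-step) rs
    ... | inj₁ (i , refl , _) with trans (sym (label-↑ˡ i)) ls
    ...   | ()
    sound s r rs ls | inj₂ (r' , refl , e2) with trans (sym (label-↑ʳ r')) ls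
    ... | refl = e2

  SStep : (V → Fin k) → S → S → Set
  SStep x σ τ = inj₁ τ ∈ step σ (x (qry σ))

  -- Completeness: with at most B successors every program step is an edge.
  module Completeness (bound : ∀ σ a → length (step σ a) ≤ B) where
    edge-complete : ∀ x σ τ → τ ∈ step σ (x (qry σ)) → Active bp x (enc E σ ↑ˡ k) (embed τ)
    edge-complete x σ τ p = edge (enc E σ) a b , cong (_↑ˡ k) src≡ , tgt≡ , qry σ ,
      trans (label-↑ˡ (enc E σ)) (cong (λ z → inj₁ (qry z)) (dec-enc E σ)) , ans≡
      where
      a : Fin k
      a = x (qry σ)
      b<B : toℕ (index p) < B
      b<B = <-≤-trans (index<length p) (bound σ a)
      b : Fin B
      b = fromℕ< b<B
      src≡ : edgeSource (edge (enc E σ) a b) ≡ enc E σ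
      src≡ = proj₁ (edge-decode (enc E σ) a b)
      ans≡ : edgeAnswer (edge (enc E σ) a b) ≡ a
      ans≡ = proj₁ (proj₂ (edge-decode (enc E σ) a b))
      cho≡ : edgeChoice (edge (enc E σ) a b) ≡ b
      cho≡ = proj₂ (proj₂ (edge-decode (enc E σ) a b))
      tgt≡ : embed (successor (dec E (edgeSource (edge (enc E σ) a b))) (edgeAnswer (edge (enc E σ) a b))
                              (edgeChoice (edge (enc E σ) a b))) ≡ embed τ
      tgt≡ rewrite src≡ | ans≡ | cho≡ | dec-enc E σ | toℕ-fromℕ< b<B = cong embed (lookupOr-index p _)

    reach-complete : ∀ x {σ} → Star (SStep x) σ0 σ → Reach bp x (enc E σ ↑ˡ k)
    reach-complete x = gmap (λ σ → enc E σ ↑ˡ k) (λ {σ} {τ} p → edge-complete x σ (inj₁ τ) p)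

    computes : (g : (V → Fin k) → Fin k) →
      (∀ x → Σ S λ σ → Star (SStep x) σ0 σ × inj₂ (g x) ∈ step σ (x (qry σ))) →
      (∀ x → OutputInvariant x (g x)) →
      Computes bp g
    computes g complete invariant x with complete x
    ... | σ , path , out =
      (m ↑ʳ g x , reach-complete x path ▷ edge-complete x σ (inj₂ (g x)) out , label-↑ʳ (g x)) ,
      Soundness.sound x (g x) (invariant x)

  deterministic : B ≡ 1 → IsDeterministic bp
  deterministic B≡1 s v ls a with splitAt m s in es
  deterministic B≡1 s v () a | inj₂ r
  deterministic B≡1 s v ls a | inj₁ i = edge i a b0 , (src≡ , ans≡) , unique
    where
    s≡ : s ≡ i ↑ˡ k
    s≡ = trans (sym (join-splitAt m k s)) (cong (join m k) es)
    b0 : Fin B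
    b0 = subst Fin (sym B≡1) F.zero
    src≡ : edgeSource (edge i a b0) ↑ˡ k ≡ s
    src≡ = trans (cong (_↑ˡ k) (proj₁ (edge-decode i a b0))) (sym s≡)
    ans≡ : edgeAnswer (edge i a b0) ≡ a
    ans≡ = proj₁ (proj₂ (edge-decode i a b0))
    only : ∀ {n} → n ≡ 1 → (z w : Fin n) → z ≡ w
    only refl F.zero F.zero = refl
    unique : ∀ j → edgeSource j ↑ˡ k ≡ s → edgeAnswer j ≡ a → j ≡ edge i a b0
    unique j sj aj = trans (sym (edge-encode j))
      (cong₃ edge (↑ˡ-injective k _ _ (trans sj s≡)) aj (only B≡1 _ b0))

inputAt-suc : ∀ M w i → inputAt M w (suc i) ≡ lookupM w i
inputAt-suc M [] i = refl
inputAt-suc M (b ∷ w) zero = refl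
inputAt-suc M (b ∷ w) (suc i) = inputAt-suc M w i

-- A work tape of bounded length is a vector; extV reads it as an infinite
-- tape, blank (zero) beyond its end.
extV : ∀ {G n} → Vec (Fin (suc G)) n → ℕ → Fin (suc G)
extV []ᵛ i = F.zero
extV (x ∷ᵛ v) zero = x
extV (x ∷ᵛ v) (suc i) = extV v i

extV-lookup : ∀ {G n} (v : Vec (Fin (suc G)) n) (p : Fin n) → extV v (toℕ p) ≡ lookup v p
extV-lookup (x ∷ᵛ v) F.zero = refl
extV-lookup (x ∷ᵛ v) (F.suc p) = extV-lookup v p

extV-blank : ∀ {G} n i → extV {G} (replicate n F.zero) i ≡ F.zero
extV-blank zero i = refl
extV-blank (suc n) zero = refl
extV-blank (suc n) (suc i) = extV-blank n i

extV-set : ∀ {G n} (v : Vec (Fin (suc G)) n) (p : Fin n) a j →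
  extV (v [ p ]≔ a) j ≡ (if j ≡ᵇ toℕ p then a else extV v j)
extV-set (x ∷ᵛ v) F.zero a zero = refl
extV-set (x ∷ᵛ v) F.zero a (suc j) = refl
extV-set (x ∷ᵛ v) (F.suc p) a zero = refl
extV-set (x ∷ᵛ v) (F.suc p) a (suc j) = extV-set v p a j

-- A segment is a variable together with the word written
-- for each of its values; a word made of segments is read off an input x by
-- concatenating the words of the values x assigns.  The input encoding of an
-- FT instance is such a word, which is what makes the simulation possible.
module Segmented {V : Set} {k : ℕ} where
  Segment : Set
  Segment = V × (Fin k → List Bool)

  segWord : (V → Fin k) → Segment → List Bool
  segWord x s = proj₂ s (x (proj₁ s))

  segLen : (V → Fin k) → Segment → ℕ
  segLen x s = length (segWord x s)

  word : ∀ {n} → Vec Segment n → (V → Fin k) → List Bool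
  word []ᵛ x = []
  word (s ∷ᵛ segs) x = segWord x s ++ word segs x

  segStart : ∀ {n} → Vec Segment n → (V → Fin k) → ℕ → ℕ
  segStart segs x zero = 0
  segStart []ᵛ x (suc i) = 0
  segStart (s ∷ᵛ segs) x (suc i) = segLen x s + segStart segs x i

  segStart-suc : ∀ {n} (segs : Vec Segment n) x (j : Fin n) →
    segStart segs x (suc (toℕ j)) ≡ segStart segs x (toℕ j) + segLen x (lookup segs j)
  segStart-suc (s ∷ᵛ segs) x F.zero = +-comm (segLen x s) 0
  segStart-suc (s ∷ᵛ segs) x (F.suc j) = trans (cong (segLen x s +_) (segStart-suc segs x j)) (sym (+-assoc (segLen x s) _ _))

  segStart-all : ∀ {n} (segs : Vec Segment n) x → segStart segs x n ≡ length (word segs x)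
  segStart-all []ᵛ x = refl
  segStart-all (s ∷ᵛ segs) x = trans (cong (segLen x s +_) (segStart-all segs x)) (sym (length-++ (segWord x s)))

  segStart≤ : ∀ {n} (segs : Vec Segment n) x i → segStart segs x i ≤ length (word segs x)
  segStart≤ segs x zero = z≤n
  segStart≤ []ᵛ x (suc i) = z≤n
  segStart≤ (s ∷ᵛ segs) x (suc i) = subst (segLen x s + segStart segs x i ≤_) (sym (length-++ (segWord x s)))
    (+-monoʳ-≤ (segLen x s) (segStart≤ segs x i))

  lookup-segment : ∀ {n} (segs : Vec Segment n) x (j : Fin n) o → o < segLen x (lookup segs j) →
    lookupM (word segs x) (segStart segs x (toℕ j) + o) ≡ lookupM (segWord x (lookup segs j)) o
  lookup-segment (s ∷ᵛ segs) x F.zero o p = lookupM-++ˡ (segWord x s) _ o p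
  lookup-segment (s ∷ᵛ segs) x (F.suc j) o p =
    trans (cong (lookupM (segWord x s ++ word segs x)) (+-assoc (segLen x s) (segStart segs x (toℕ j)) o))
      (trans (lookupM-++ʳ (segWord x s) (word segs x) _) (lookup-segment segs x j o p))

  wordLen≤ : ∀ {n} (segs : Vec Segment n) x B → (∀ j → segLen x (lookup segs j) ≤ B) → length (word segs x) ≤ n * B
  wordLen≤ []ᵛ x B h = z≤n
  wordLen≤ (s ∷ᵛ segs) x B h =
    subst (_≤ B + _) (sym (length-++ (segWord x s))) (+-mono-≤ (h F.zero) (wordLen≤ segs x B (λ j → h (F.suc j))))

-- Compressed input-head positions on a word of segments 0 … lastSeg: an end
-- marker, or a segment with an offset.  The offset is a number below the
-- maximal segment length, or "the last letter" of the segment (whose position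
-- depends on the value of the segment's variable).
data Pos (lastSeg maxOff : ℕ) : Set where
  leftEnd : Pos lastSeg maxOff
  inSeg : Fin (suc lastSeg) → Fin (suc maxOff) ⊎ ⊤ → Pos lastSeg maxOff
  rightEnd : Pos lastSeg maxOff

-- Simulation of a space-bounded machine M on a word of segments by "core"
-- configurations: state, a work tape of maxCell+1 cells, work-head position
-- and compressed input-head position.  A core configuration knows which variable decides
-- the input symbol under the head; given its value, it determines the set of
-- successor cores.
module CoreSimulation (M : TM) {V : Set} (k : ℕ) (lastSeg : ℕ) (segs : Vec (Segmented.Segment {V} {k}) (suc lastSeg))
  (maxOff maxCell : ℕ)
  (segNonEmpty : ∀ j a → 1 ≤ length (proj₂ (lookup segs j) a))
  (segBounded : ∀ j a → length (proj₂ (lookup segs j) a) ≤ suc maxOff) where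
  open TM M
  open Segmented {V} {k}

  Offset : Set
  Offset = Fin (suc maxOff) ⊎ ⊤
  Position : Set
  Position = Pos lastSeg maxOff

  lenAt : Fin (suc lastSeg) → Fin k → ℕ
  lenAt j a = length (proj₂ (lookup segs j) a)

  offsetOf : Fin (suc lastSeg) → Fin k → Offset → ℕ
  offsetOf j a (inj₁ o) = toℕ o
  offsetOf j a (inj₂ _) = pred (lenAt j a)

  toOffsetD : ∀ i → Dec (i < suc maxOff) → Offset
  toOffsetD i (yes p) = inj₁ (fromℕ< p)
  toOffsetD i (no _) = inj₂ tt

  toOffset : ℕ → Offset
  toOffset i = toOffsetD i (i <? suc maxOff)

  offsetOf-toOffset : ∀ j a i → i < suc maxOff → offsetOf j a (toOffset i) ≡ i
  offsetOf-toOffset j a i lt with i <? suc maxOff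
  ... | yes p = toℕ-fromℕ< p
  ... | no np = ⊥-elim (np lt)

  segVar : Fin (suc lastSeg) → V
  segVar j = proj₁ (lookup segs j)

  posVar : Position → V
  posVar (inSeg j o) = segVar j
  posVar _ = segVar F.zero

  posSymbol : Fin k → Position → Maybe Bool
  posSymbol a (inSeg j o) = lookupM (proj₂ (lookup segs j) a) (offsetOf j a o)
  posSymbol a _ = nothing

  moveLeft : Fin (suc lastSeg) → ℕ → Position
  moveLeft j (suc o) = inSeg j (toOffset o)
  moveLeft F.zero zero = leftEnd
  moveLeft (F.suc j') zero = inSeg (inject₁ j') (inj₂ tt)

  nextSegment : (j : Fin (suc lastSeg)) → Dec (toℕ j < lastSeg) → Position
  nextSegment j (yes q) = inSeg (fromℕ< (s≤s q)) (toOffset 0)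
  nextSegment j (no _) = rightEnd

  moveRightD : (j : Fin (suc lastSeg)) (a : Fin k) (n : ℕ) → Dec (suc n < lenAt j a) → Position
  moveRightD j a n (yes _) = inSeg j (toOffset (suc n))
  moveRightD j a n (no _) = nextSegment j (toℕ j <? lastSeg)

  moveRight : Fin (suc lastSeg) → Fin k → ℕ → Position
  moveRight j a n = moveRightD j a n (suc n <? lenAt j a)

  movePos : Fin k → Position → Move → Position
  movePos a p stay = p
  movePos a leftEnd left = leftEnd
  movePos a leftEnd right = inSeg F.zero (toOffset 0)
  movePos a rightEnd left = inSeg (fromℕ lastSeg) (inj₂ tt)
  movePos a rightEnd right = rightEnd
  movePos a (inSeg j o) right = moveRight j a (offsetOf j a o)
  movePos a (inSeg j o) left = moveLeft j (offsetOf j a o)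

  module _ (x : V → Fin k) where
    w : List Bool
    w = word segs x

    answer : Fin (suc lastSeg) → Fin k
    answer j = x (segVar j)

    headPos : Position → ℕ
    headPos leftEnd = 0
    headPos rightEnd = suc (length w)
    headPos (inSeg j o) = suc (segStart segs x (toℕ j) + offsetOf j (answer j) o)

    Valid : Position → Set
    Valid (inSeg j o) = offsetOf j (answer j) o < lenAt j (answer j)
    Valid _ = ⊤

    posSymbol-correct : ∀ p → Valid p → inputAt M w (headPos p) ≡ posSymbol (x (posVar p)) p
    posSymbol-correct leftEnd v = refl
    posSymbol-correct rightEnd v = trans (inputAt-suc M w (length w)) (lookupM-length w)
    posSymbol-correct (inSeg j o) v = trans (inputAt-suc M w _) (lookup-segment segs x j _ v)

    segEnd≤ : ∀ j → segStart segs x (toℕ j) + lenAt j (answer j) ≤ length w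
    segEnd≤ j = subst (_≤ length w) (segStart-suc segs x j) (segStart≤ segs x (suc (toℕ j)))

    lastSegEnd≡ : ∀ j → toℕ j ≡ lastSeg → segStart segs x (toℕ j) + lenAt j (answer j) ≡ length w
    lastSegEnd≡ j e = trans (sym (segStart-suc segs x j)) (trans (cong (λ z → segStart segs x (suc z)) e) (segStart-all segs x))

    nonEmpty : ∀ j → 0 < lenAt j (answer j)
    nonEmpty j = segNonEmpty j (answer j)

    suc-pred-len : ∀ j → suc (pred (lenAt j (answer j))) ≡ lenAt j (answer j)
    suc-pred-len j = suc-pred (lenAt j (answer j)) {{>-nonZero (nonEmpty j)}}

    Valid-last : ∀ j → Valid (inSeg j (inj₂ tt))
    Valid-last j = ≤-reflexive (suc-pred-len j)

    Valid-first : ∀ j → Valid (inSeg j (toOffset 0))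
    Valid-first j = subst (_< lenAt j (answer j)) (sym (offsetOf-toOffset j (answer j) 0 (s≤s z≤n))) (nonEmpty j)

    moveRight-correct : ∀ j n → n < lenAt j (answer j) → ∀ d →
      suc (suc (segStart segs x (toℕ j) + n)) ⊓ suc (length w) ≡ headPos (moveRightD j (answer j) n d)
      × Valid (moveRightD j (answer j) n d)
    moveRight-correct j n lt (yes p) =
      trans (m≤n⇒m⊓n≡m (s≤s inside)) (cong suc (trans (sym (+-suc _ n)) (cong (segStart segs x (toℕ j) +_) (sym stored)))) ,
      subst (_< lenAt j (answer j)) (sym stored) p
      where
      stored : offsetOf j (answer j) (toOffset (suc n)) ≡ suc n
      stored = offsetOf-toOffset j (answer j) (suc n) (≤-trans p (segBounded j (answer j)))
      inside : suc (segStart segs x (toℕ j) + n) ≤ length w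
      inside = ≤-trans (≤-reflexive (sym (+-suc _ n))) (≤-trans (+-monoʳ-≤ (segStart segs x (toℕ j)) (<⇒≤ p)) (segEnd≤ j))
    moveRight-correct j n lt (no np) = go (toℕ j <? lastSeg)
      where
      segEnd : suc (segStart segs x (toℕ j) + n) ≡ segStart segs x (toℕ j) + lenAt j (answer j)
      segEnd = trans (sym (+-suc _ n)) (cong (segStart segs x (toℕ j) +_) (≤-antisym lt (≮⇒≥ np)))
      go : (d : Dec (toℕ j < lastSeg)) →
        suc (suc (segStart segs x (toℕ j) + n)) ⊓ suc (length w) ≡ headPos (nextSegment j d) × Valid (nextSegment j d)
      go (yes q) = trans (m≤n⇒m⊓n≡m (s≤s (subst (_≤ length w) (sym segEnd) (segEnd≤ j)))) (cong suc nextStart) ,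
                   Valid-first _
        where
        j' : Fin (suc lastSeg)
        j' = fromℕ< (s≤s q)
        nextStart : suc (segStart segs x (toℕ j) + n) ≡ segStart segs x (toℕ j') + offsetOf j' (answer j') (toOffset 0)
        nextStart = begin
          suc (segStart segs x (toℕ j) + n)              ≡⟨ segEnd ⟩
          segStart segs x (toℕ j) + lenAt j (answer j)   ≡⟨ sym (segStart-suc segs x j) ⟩
          segStart segs x (suc (toℕ j))                  ≡⟨ cong (segStart segs x) (sym (toℕ-fromℕ< (s≤s q))) ⟩
          segStart segs x (toℕ j')                       ≡⟨ sym (+-identityʳ _) ⟩
          segStart segs x (toℕ j') + 0                   ≡⟨ cong (segStart segs x (toℕ j') +_)
                                                              (sym (offsetOf-toOffset j' (answer j') 0 (s≤s z≤n))) ⟩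
          segStart segs x (toℕ j') + offsetOf j' (answer j') (toOffset 0) ∎
          where open ≡-Reasoning
      go (no nq) = trans (cong (λ z → suc z ⊓ suc (length w)) (trans segEnd (lastSegEnd≡ j
          (≤-antisym (toℕ≤pred[n] j) (≮⇒≥ nq))))) (⊓-idem _) , tt

    moveLeft-correct : ∀ j n → n < lenAt j (answer j) →
      pred (suc (segStart segs x (toℕ j) + n)) ≡ headPos (moveLeft j n) × Valid (moveLeft j n)
    moveLeft-correct j (suc o) lt = trans (+-suc _ o) (cong (λ z → suc (segStart segs x (toℕ j) + z)) (sym no≡)) ,
        subst (_< lenAt j (answer j)) (sym no≡) (<⇒≤ lt)
      where
      no≡ : offsetOf j (answer j) (toOffset o) ≡ o
      no≡ = offsetOf-toOffset j (answer j) o (≤-trans (<⇒≤ lt) (segBounded j (answer j)))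
    moveLeft-correct F.zero zero lt = refl , tt
    moveLeft-correct (F.suc j') zero lt = goal , Valid-last i
      where
      i : Fin (suc lastSeg)
      i = inject₁ j'
      goal : segStart segs x (suc (toℕ j')) + 0 ≡ suc (segStart segs x (toℕ i) + pred (lenAt i (answer i)))
      goal = begin
        segStart segs x (suc (toℕ j')) + 0                       ≡⟨ +-identityʳ _ ⟩
        segStart segs x (suc (toℕ j'))                           ≡⟨ cong (λ z → segStart segs x (suc z)) (sym (toℕ-inject₁ j')) ⟩
        segStart segs x (suc (toℕ i))                            ≡⟨ segStart-suc segs x i ⟩
        segStart segs x (toℕ i) + lenAt i (answer i)             ≡⟨ cong (segStart segs x (toℕ i) +_) (sym (suc-pred-len i)) ⟩
        segStart segs x (toℕ i) + suc (pred (lenAt i (answer i))) ≡⟨ +-suc _ _ ⟩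
        suc (segStart segs x (toℕ i) + pred (lenAt i (answer i))) ∎
        where open ≡-Reasoning

    movePos-correct : ∀ p mv → Valid p →
      moveI M (length w) mv (headPos p) ≡ headPos (movePos (x (posVar p)) p mv) × Valid (movePos (x (posVar p)) p mv)
    movePos-correct p stay v = refl , v
    movePos-correct leftEnd left v = refl , tt
    movePos-correct leftEnd right v = cong suc (sym (offsetOf-toOffset F.zero (answer F.zero) 0 (s≤s z≤n))) , Valid-first F.zero
    movePos-correct rightEnd left v = sym lastLetter , Valid-last (fromℕ lastSeg)
      where
      last : Fin (suc lastSeg)
      last = fromℕ lastSeg
      lastLetter : suc (segStart segs x (toℕ last) + pred (lenAt last (answer last))) ≡ length w
      lastLetter = begin
        suc (segStart segs x (toℕ last) + pred (lenAt last (answer last))) ≡⟨ sym (+-suc _ _) ⟩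
        segStart segs x (toℕ last) + suc (pred (lenAt last (answer last))) ≡⟨ cong (segStart segs x (toℕ last) +_) (suc-pred-len last) ⟩
        segStart segs x (toℕ last) + lenAt last (answer last)             ≡⟨ lastSegEnd≡ last (toℕ-fromℕ lastSeg) ⟩
        length w                                                          ∎
        where open ≡-Reasoning
    movePos-correct rightEnd right v = m≥n⇒m⊓n≡n (n≤1+n _) , tt
    movePos-correct (inSeg j o) left v = moveLeft-correct j (offsetOf j (answer j) o) v
    movePos-correct (inSeg j o) right v =
      moveRight-correct j (offsetOf j (answer j) o) v (suc (offsetOf j (answer j) o) <? lenAt j (answer j))

  Transition : Set
  Transition = Fin Q × Fin (suc G) × Move × Move

  Core : Set
  Core = Fin Q × Vec (Fin (suc G)) (suc maxCell) × Fin (suc maxCell) × Position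

  applyD : Core → Fin k → (tr : Transition) → ∀ {nw} → Dec (nw < suc maxCell) → Maybe Core
  applyD (q , t , p , ps) a (q' , g' , mi , mw) {nw} (yes lt) = just (q' , (t [ p ]≔ g') , fromℕ< lt , movePos a ps mi)
  applyD σ a tr (no _) = nothing

  applyTransition : Core → Fin k → Transition → Maybe Core
  applyTransition σ@(q , t , p , ps) a tr@(q' , g' , mi , mw) = applyD σ a tr (moveW M mw (toℕ p) <? suc maxCell)

  coreNext : Core → Fin k → List Core
  coreNext σ@(q , t , p , ps) a = mapMaybe (applyTransition σ a) (δ q (posSymbol a ps) (lookup t p))

  coreVar : Core → V
  coreVar (q , t , p , ps) = posVar ps

  Represents : (V → Fin k) → Config M → Core → Set
  Represents x c (q , t , p , ps) = Config.state c ≡ q × Config.ipos c ≡ headPos x ps × Config.wpos c ≡ toℕ p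
    × (∀ i → Config.wtape c i ≡ extV t i) × Valid x ps

  core0 : Core
  core0 = start , replicate _ F.zero , F.zero , leftEnd

  represents-initial : ∀ x → Represents x (initial M) core0
  represents-initial x = refl , refl , refl , (λ i → sym (extV-blank (suc maxCell) i)) , tt

  represents-next : ∀ x c q t p ps q' g' mi mw → Represents x c (q , t , p , ps) →
    (lt : moveW M mw (toℕ p) < suc maxCell) →
    Represents x (next M (w x) c (q' , g' , mi , mw)) (q' , (t [ p ]≔ g') , fromℕ< lt , movePos (x (posVar ps)) ps mi)
  represents-next x (cfg qq ii tp wp) q t p ps q' g' mi mw (e1 , refl , refl , e4 , v) lt =
    refl , proj₁ (movePos-correct x ps mi v) , sym (toℕ-fromℕ< lt) , tape , proj₂ (movePos-correct x ps mi v)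
    where
    tape : ∀ i → write M tp (toℕ p) g' i ≡ extV (t [ p ]≔ g') i
    tape i rewrite extV-set t p g' i with i ≡ᵇ toℕ p
    ... | true = refl
    ... | false = e4 i

  δ-agrees : ∀ x c q t p ps → Represents x c (q , t , p , ps) →
    δ (Config.state c) (inputAt M (w x) (Config.ipos c)) (Config.wtape c (Config.wpos c))
    ≡ δ q (posSymbol (x (posVar ps)) ps) (lookup t p)
  δ-agrees x c q t p ps (e1 , e2 , e3 , e4 , v) = cong₃ δ e1 sameSymbol sameCell
    where
    sameSymbol : inputAt M (w x) (Config.ipos c) ≡ posSymbol (x (posVar ps)) ps
    sameSymbol = trans (cong (inputAt M (w x)) e2) (posSymbol-correct x ps v)
    sameCell : Config.wtape c (Config.wpos c) ≡ lookup t p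
    sameCell = trans (cong (Config.wtape c) e3) (trans (e4 (toℕ p)) (extV-lookup t p))

  simulate-forward : ∀ x c σ σ' → Represents x c σ → σ' ∈ coreNext σ (x (coreVar σ)) →
    Σ (Config M) λ c' → Step M (w x) c c' × Represents x c' σ'
  simulate-forward x c σ@(q , t , p , ps) σ' r m with mapMaybe-∈⁻ (applyTransition σ (x (posVar ps))) _ m
  ... | tr@(q' , g' , mi , mw) , tm , ap with moveW M mw (toℕ p) <? suc maxCell
  ... | yes lt with ap
  ...   | refl = next M (w x) c tr , step tr (subst (tr ∈_) (sym (δ-agrees x c q t p ps r)) tm) ,
                 represents-next x c q t p ps q' g' mi mw r lt
  simulate-forward x c σ@(q , t , p , ps) σ' r m | tr@(q' , g' , mi , mw) , tm , () | no _

  simulate-backward : ∀ x c σ c' → Represents x c σ → Step M (w x) c c' → Config.wpos c' < suc maxCell →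
    Σ Core λ σ' → σ' ∈ coreNext σ (x (coreVar σ)) × Represents x c' σ'
  simulate-backward x c σ@(q , t , p , ps) c' r (step tr@(q' , g' , mi , mw) tm) wl
    with moveW M mw (toℕ p) <? suc maxCell in eqd
  ... | yes lt = _ , mapMaybe-∈⁺ (applyTransition σ (x (posVar ps))) (subst (tr ∈_) (δ-agrees x c q t p ps r) tm) applied ,
                 represents-next x c q t p ps q' g' mi mw r lt
    where
    applied : applyTransition σ (x (posVar ps)) tr ≡ just (q' , (t [ p ]≔ g') , fromℕ< lt , movePos (x (posVar ps)) ps mi)
    applied rewrite eqd = refl
  ... | no nlt = ⊥-elim (nlt (subst (λ z → moveW M mw z < suc maxCell) (proj₁ (proj₂ (proj₂ r))) wl))

-- A number is written with every
-- bit doubled and terminated by 01, so encNum m ++ r determines m and r; an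
-- encoding determines the instance, and BT_d is exactly "root value 1".

dbl : List Bool → List Bool
dbl = concatMap (λ b → b ∷ b ∷ [])

dbl-inj : ∀ l l' r r' → dbl l ++ (false ∷ true ∷ r) ≡ dbl l' ++ (false ∷ true ∷ r') → l ≡ l' × r ≡ r'
dbl-inj [] [] r r' refl = refl , refl
dbl-inj [] (false ∷ l') r r' ()
dbl-inj [] (true ∷ l') r r' ()
dbl-inj (false ∷ l) [] r r' ()
dbl-inj (true ∷ l) [] r r' ()
dbl-inj (b ∷ l) (b' ∷ l') r r' e with e
... | e' with cong (λ { (z ∷ _) → z ; [] → b }) e'
... | refl with dbl-inj l l' r r' (cong (λ { (_ ∷ _ ∷ z) → z ; _ → dbl l ++ (false ∷ true ∷ r) }) e')
... | refl , e2 = refl , e2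

bit : Bool → ℕ
bit true = 1
bit false = 0

fromBitsA : ℕ → List Bool → ℕ
fromBitsA acc [] = acc
fromBitsA acc (b ∷ l) = fromBitsA (2 * acc + bit b) l

fromBitsA-snoc : ∀ acc l b → fromBitsA acc (l ++ [ b ]) ≡ 2 * fromBitsA acc l + bit b
fromBitsA-snoc acc [] b = refl
fromBitsA-snoc acc (x ∷ l) b = fromBitsA-snoc (2 * acc + bit x) l b

bit-mod : ∀ m → bit (m % 2 ≡ᵇ 1) ≡ m % 2
bit-mod m with m % 2 | m%n<n m 2
... | zero | _ = refl
... | suc zero | _ = refl
... | suc (suc _) | s≤s (s≤s ())

fromBits-bitsAux : ∀ f m → m ≤ f → fromBitsA 0 (bitsAux f m) ≡ m
fromBits-bitsAux zero zero _ = refl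
fromBits-bitsAux (suc f) zero _ = refl
fromBits-bitsAux (suc f) (suc m) (s≤s le) = begin
  fromBitsA 0 (bitsAux f (suc m / 2) ++ [ suc m % 2 ≡ᵇ 1 ])       ≡⟨ fromBitsA-snoc 0 (bitsAux f (suc m / 2)) (suc m % 2 ≡ᵇ 1) ⟩
  2 * fromBitsA 0 (bitsAux f (suc m / 2)) + bit (suc m % 2 ≡ᵇ 1) ≡⟨ cong₂ (λ a b → 2 * a + b) (fromBits-bitsAux f (suc m / 2) half≤)
                                                                                          (bit-mod (suc m)) ⟩
  2 * (suc m / 2) + suc m % 2                                     ≡⟨ swap (suc m / 2) (suc m % 2) ⟩
  suc m % 2 + suc m / 2 * 2                                       ≡⟨ sym (m≡m%n+[m/n]*n (suc m) 2) ⟩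
  suc m                                                           ∎
  where
  open ≡-Reasoning
  half≤ : suc m / 2 ≤ f
  half≤ = ≤-trans (≤-pred (m/n<m (suc m) 2 (s≤s (s≤s z≤n)))) le
  swap : ∀ a b → 2 * a + b ≡ b + a * 2
  swap = solve-∀

bits-inj : ∀ m m' → bits m ≡ bits m' → m ≡ m'
bits-inj m m' e = trans (sym (fromBits-bitsAux m m ≤-refl)) (trans (cong (fromBitsA 0) e) (fromBits-bitsAux m' m' ≤-refl))

encNum-inj : ∀ m m' r r' → encNum m ++ r ≡ encNum m' ++ r' → m ≡ m' × r ≡ r'
encNum-inj m m' r r' e with dbl-inj (bits m) (bits m') r r'
  (trans (sym (++-assoc (dbl (bits m)) (false ∷ true ∷ []) r)) (trans e (++-assoc (dbl (bits m')) (false ∷ true ∷ []) r')))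
... | e1 , e2 = bits-inj m m' e1 , e2


allVecs-∈ : ∀ k d (u : Vec (Fin k) d) → u ∈ allVecs k d
allVecs-∈ k zero []ᵛ = here refl
allVecs-∈ k (suc d) (a ∷ᵛ u) =
  ∈-concatMap⁺ (λ a → map (a ∷ᵛ_) (allVecs k d)) (lose (∈-allFin a) (∈-map⁺ (a ∷ᵛ_) (allVecs-∈ k d u)))

enum-∈ : ∀ d k n (v : Var d k n) → v ∈ enum d k n
enum-∈ d k zero tt = here refl
enum-∈ d k (suc n) (inj₁ u) = ∈-++⁺ˡ (∈-map⁺ inj₁ (allVecs-∈ k d u))
enum-∈ d k (suc n) (inj₂ (j , v)) = ∈-++⁺ʳ (map inj₁ (allVecs k d))
  (∈-concatMap⁺ (λ j → map (λ v → inj₂ (j , v)) (enum d k n)) (lose (∈-allFin j) (∈-map⁺ (λ v → inj₂ (j , v)) (enum-∈ d k n v))))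

body-inj : ∀ {X : Set} {k} (l : List X) (f g : X → Fin k) →
  concatMap (λ v → encNum (suc (toℕ (f v)))) l ≡ concatMap (λ v → encNum (suc (toℕ (g v)))) l →
  ∀ v → v ∈ l → f v ≡ g v
body-inj (a ∷ l) f g e v p with encNum-inj (suc (toℕ (f a))) (suc (toℕ (g a))) _ _ e
body-inj (a ∷ l) f g e v (here refl) | e1 , e2 = toℕ-injective (suc-injective e1)
body-inj (a ∷ l) f g e v (there p) | e1 , e2 = body-inj l f g e2 v p

eval-cong : ∀ d k n (y y' : Var d k n → Fin k) → (∀ v → y v ≡ y' v) → eval d k n y ≡ eval d k n y'
eval-cong d k zero y y' e = e tt
eval-cong d k (suc n) y y' e = trans (e _) (cong (λ t → y' (inj₁ t))
  (tabulate-cong (λ j → eval-cong d k n _ _ (λ v → e (inj₂ (j , v))))))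

BT-sound : ∀ d n k0 (y : Var d (suc k0) n → Fin (suc k0)) → BT d (encode d n (suc k0) y) → eval d (suc k0) n y ≡ F.zero
BT-sound d n k0 y (n' , k'' , y' , e , ev) with encNum-inj (suc n) (suc n') _ _ e
... | e1 , e2 with suc-injective e1
... | refl with encNum-inj (suc k0) (suc k'') _ _ e2
... | e3 , e4 with suc-injective e3
... | refl = trans (eval-cong d (suc k0) n y y' (λ v → body-inj (enum d (suc k0) n) y y' e4 v (enum-∈ d (suc k0) n v))) ev

BT-complete : ∀ d n k0 (y : Var d (suc k0) n → Fin (suc k0)) → eval d (suc k0) n y ≡ F.zero → BT d (encode d n (suc k0) y)
BT-complete d n k0 y ev = n , k0 , y , refl , ev

len-dbl : ∀ l → length (dbl l) ≡ 2 * length l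
len-dbl [] = refl
len-dbl (b ∷ l) = trans (cong (λ z → suc (suc z)) (len-dbl l)) (cong suc (sym (+-suc (length l) (length l + 0))))

len-bitsAux : ∀ f m → length (bitsAux f m) ≤ f
len-bitsAux zero m = z≤n
len-bitsAux (suc f) zero = z≤n
len-bitsAux (suc f) (suc m) = subst (_≤ suc f) (sym (trans (length-++ (bitsAux f (suc m / 2))) (+-comm _ 1)))
  (s≤s (len-bitsAux f _))

len-encNum : ∀ m → length (encNum m) ≡ 2 * length (bits m) + 2
len-encNum m = trans (length-++ (dbl (bits m))) (cong (_+ 2) (len-dbl (bits m)))

encNum≤ : ∀ m → length (encNum m) ≤ 2 * m + 2
encNum≤ m = subst (_≤ 2 * m + 2) (sym (len-encNum m)) (+-monoˡ-≤ 2 (*-monoʳ-≤ 2 (len-bitsAux m m)))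

encNum≥ : ∀ m → 1 ≤ length (encNum m)
encNum≥ m = subst (1 ≤_) (sym (len-encNum m)) (≤-trans (s≤s z≤n) (m≤n+m 2 _))

len-concatMap : ∀ {A B : Set} (f : A → List B) L (l : List A) → (∀ a → length (f a) ≡ L) → length (concatMap f l) ≡ length l * L
len-concatMap f L [] h = refl
len-concatMap f L (a ∷ l) h = trans (length-++ (f a)) (cong₂ _+_ (h a) (len-concatMap f L l h))

len-allFin : ∀ n → length (allFin n) ≡ n
len-allFin n = length-tabulate {n = n} (λ i → i)

len-allVecs : ∀ k d → length (allVecs k d) ≡ k ^ d
len-allVecs k zero = refl
len-allVecs k (suc d) = trans (len-concatMap _ (k ^ d) (allFin k) (λ a → trans (length-map _ (allVecs k d)) (len-allVecs k d)))
  (cong (_* k ^ d) (len-allFin k))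

-- number of nodes (+ leaves) of a tree with n internal levels
varBound : ℕ → ℕ → ℕ
varBound d zero = 1
varBound d (suc n) = 1 + d * varBound d n

len-enum : ∀ d k0 n → length (enum d (suc k0) n) ≤ varBound d n * suc k0 ^ d
len-enum d k0 zero = ≤-trans (m^n>0 (suc k0) d) (≤-reflexive (sym (+-identityʳ _)))
len-enum d k0 (suc n) = ≤-trans (≤-reflexive e1) (≤-trans (+-monoʳ-≤ (K ^ d) (*-monoʳ-≤ d (len-enum d k0 n)))
    (≤-reflexive (lem (K ^ d) d (varBound d n))))
  where
  K : ℕ
  K = suc k0
  e1 : length (enum d K (suc n)) ≡ K ^ d + d * length (enum d K n)
  e1 = trans (length-++ (map inj₁ (allVecs K d)))
         (cong₂ _+_ (trans (length-map _ (allVecs K d)) (len-allVecs K d))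
                    (trans (len-concatMap _ (length (enum d K n)) (allFin d) (λ j → length-map _ (enum d K n)))
                           (cong (_* length (enum d K n)) (len-allFin d))))
  lem : ∀ u d m → u + d * (m * u) ≡ (1 + d * m) * u
  lem = solve-∀

-- The swapping trick.  swap₀ r exchanges the values r and 1 (= zero); a
-- machine deciding "root = 1" on the instance whose root function is composed
-- with swap₀ r decides "root = r" on the original instance.
swap₀ : ∀ {k} → Fin (suc k) → Fin (suc k) → Fin (suc k)
swap₀ r a with a ≟ r
... | yes _ = F.zero
... | no _ with a ≟ F.zero
... | yes _ = r
... | no _ = a

swap₀-self : ∀ {k} (r : Fin (suc k)) → swap₀ r r ≡ F.zero
swap₀-self r with r ≟ r
... | yes _ = refl
... | no ne = ⊥-elim (ne refl)

swap₀-zero : ∀ {k} (r a : Fin (suc k)) → swap₀ r a ≡ F.zero → a ≡ r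
swap₀-zero r a e with a ≟ r
... | yes p = p
... | no ne with a ≟ F.zero
... | yes p = ⊥-elim (ne (trans p (sym e)))
... | no nz = ⊥-elim (nz e)

-- A fixed instance size: arity d, h = n+1 ≥ 2 levels, k = k0+1 ≥ 1 values.
-- The encoding is a word of segments: the header (h and k), then one segment
-- per variable, in the order of enum.
module Instance (d n' k0 : ℕ) where
  k : ℕ
  k = suc k0
  n : ℕ
  n = suc n'
  V : Set
  V = Var d k n
  open Segmented {V} {k}

  -- a variable to query where the answer is irrelevant
  someVar : V
  someVar = inj₁ (replicate d F.zero)

  opaque
    header : List Bool
    header = encNum (suc n) ++ encNum k

    valueWord : Fin k → List Bool
    valueWord a = encNum (suc (toℕ a))

    varSegments : (l : List V) → Vec Segment (length l)
    varSegments [] = []ᵛ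
    varSegments (v ∷ l) = (v , valueWord) ∷ᵛ varSegments l

    lastSeg : ℕ
    lastSeg = length (enum d k n)

    segs : Vec Segment (suc lastSeg)
    segs = (someVar , (λ _ → header)) ∷ᵛ varSegments (enum d k n)

    maxOff : ℕ
    maxOff = (2 * suc n + 2) + (2 * k + 2)

    lookup-varSegments : ∀ l j → proj₂ (lookup (varSegments l) j) ≡ valueWord
    lookup-varSegments (v ∷ l) F.zero = refl
    lookup-varSegments (v ∷ l) (F.suc j) = lookup-varSegments l j

    segNonEmpty : ∀ j a → 1 ≤ length (proj₂ (lookup segs j) a)
    segNonEmpty F.zero a = subst (1 ≤_) (sym (length-++ (encNum (suc n)))) (≤-trans (encNum≥ (suc n)) (m≤m+n _ _))
    segNonEmpty (F.suc j) a rewrite lookup-varSegments (enum d k n) j = encNum≥ (suc (toℕ a))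

    valueWord≤ : ∀ (a : Fin k) → length (valueWord a) ≤ 2 * k + 2
    valueWord≤ a = ≤-trans (encNum≤ (suc (toℕ a))) (+-monoˡ-≤ 2 (*-monoʳ-≤ 2 (toℕ<n a)))

    segBounded : ∀ j a → length (proj₂ (lookup segs j) a) ≤ suc maxOff
    segBounded F.zero a = ≤-trans (≤-reflexive (length-++ (encNum (suc n)))) (≤-trans (+-mono-≤ (encNum≤ (suc n)) (encNum≤ k)) (n≤1+n _))
    segBounded (F.suc j) a rewrite lookup-varSegments (enum d k n) j =
      ≤-trans (valueWord≤ a) (≤-trans (m≤n+m (2 * k + 2) (2 * suc n + 2)) (n≤1+n _))

    word-varSegments : ∀ l x → word (varSegments l) x ≡ concatMap (λ v → encNum (suc (toℕ (x v)))) l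
    word-varSegments [] x = refl
    word-varSegments (v ∷ l) x = cong (valueWord (x v) ++_) (word-varSegments l x)

    word≡ : ∀ x → word segs x ≡ encode d n k x
    word≡ x = trans (++-assoc (encNum (suc n)) (encNum k) _)
                    (cong (λ z → encNum (suc n) ++ encNum k ++ z) (word-varSegments (enum d k n) x))

    maxLen : ℕ
    maxLen = suc lastSeg * suc maxOff

    wordLen : ∀ x → length (word segs x) ≤ maxLen
    wordLen x = wordLen≤ segs x (suc maxOff) (λ j → segBounded j _)

    -- the defining equations, for use outside the opaque block
    lastSeg≡ : lastSeg ≡ length (enum d k n)
    lastSeg≡ = refl

    maxOff≡ : maxOff ≡ (2 * suc n + 2) + (2 * k + 2)
    maxOff≡ = refl

    maxLen≡ : maxLen ≡ suc lastSeg * suc maxOff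
    maxLen≡ = refl

  -- swap r and 1 in the root function; then eval (swapped r x) = swap₀ r (eval x)
  swapAtRoot : Fin k → V → Fin k → Fin k
  swapAtRoot r (inj₁ u) a = swap₀ r a
  swapAtRoot r (inj₂ _) a = a

  swapped : Fin k → (V → Fin k) → V → Fin k
  swapped r x v = swapAtRoot r v (x v)


  module Decider (M : TM) (c0 : ℕ) (decM : Decides M (BT d))
    (ls : ∀ w conf → Reachable M w conf → Config.wpos conf ≤ c0 * suc ⌊log₂ length w ⌋) where

    opaque
      maxCell : ℕ
      maxCell = c0 * suc ⌊log₂ maxLen ⌋

      maxCell≡ : maxCell ≡ c0 * suc ⌊log₂ maxLen ⌋
      maxCell≡ = refl

    open CoreSimulation M k lastSeg segs maxOff maxCell segNonEmpty segBounded public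

    workHead-bounded : ∀ x c → Reachable M (word segs x) c → Config.wpos c < suc maxCell
    workHead-bounded x c r = subst (λ z → Config.wpos c < suc z) (sym maxCell≡)
      (s≤s (≤-trans (ls _ c r) (*-monoʳ-≤ c0 (s≤s (⌊log₂⌋-mono-≤ (wordLen x))))))

    accepts-sound : ∀ r x → Accepts M (word segs (swapped r x)) → eval d k n x ≡ r
    accepts-sound r x a =
      swap₀-zero r _ (BT-sound d n k0 (swapped r x) (proj₂ (decM _) (subst (Accepts M) (word≡ (swapped r x)) a)))

    accepts-complete : ∀ x → Accepts M (word segs (swapped (eval d k n x) x))
    accepts-complete x =
      subst (Accepts M) (sym (word≡ (swapped _ x))) (proj₁ (decM _) (BT-complete d n k0 (swapped _ x) (swap₀-self (eval d k n x))))

    CoreStep : (V → Fin k) → Core → Core → Set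
    CoreStep y σ σ' = σ' ∈ coreNext σ (y (coreVar σ))

    reachable-core : ∀ y c → Reachable M (word segs y) c →
      Σ Core λ σ → Star (CoreStep y) core0 σ × Represents y c σ
    reachable-core y c rc = star-ind Simulated (core0 , ε , represents-initial y) extend rc
      where
      Simulated : Config M → Set
      Simulated c = Σ Core λ σ → Star (CoreStep y) core0 σ × Represents y c σ
      extend : ∀ {s t} → Reachable M (word segs y) s → Simulated s → Step M (word segs y) s t → Simulated t
      extend {s} {t} pre (σ , path , rl) st with simulate-backward y s σ t rl st (workHead-bounded y t (pre ▷ st))
      ... | σ' , m , rl' = σ' , path ▷ m , rl'

module TransitionBound (M : TM) where
  open TM M
  branchCount : Fin Q → Fin (suc G) → ℕ
  branchCount q g = length (δ q nothing g) + length (δ q (just false) g) + length (δ q (just true) g)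
  maxBranch : ℕ
  maxBranch = finSum Q (λ q → finSum (suc G) (λ g → branchCount q g))
  δ≤maxBranch : ∀ q s g → length (δ q s g) ≤ maxBranch
  δ≤maxBranch q s g = ≤-trans (δ≤branchCount s)
    (≤-trans (≤finSum (suc G) (λ g → branchCount q g) g) (≤finSum Q (λ q → finSum (suc G) (λ g → branchCount q g)) q))
    where
    δ≤branchCount : ∀ s → length (δ q s g) ≤ branchCount q g
    δ≤branchCount nothing = ≤-trans (m≤m+n _ _) (m≤m+n _ _)
    δ≤branchCount (just false) =
      ≤-trans (m≤n+m (length (δ q (just false) g)) (length (δ q nothing g))) (m≤m+n _ (length (δ q (just true) g)))
    δ≤branchCount (just true) = m≤n+m _ _

module StateSpaces (Q G maxCell lastSeg maxOff : ℕ) where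
  posE : FinEnc (Pos lastSeg maxOff)
  posE = retractE (⊤E ⊎E ((finE (suc lastSeg) ×E (finE (suc maxOff) ⊎E ⊤E)) ⊎E ⊤E)) f g gf
    where
    f : Pos lastSeg maxOff → ⊤ ⊎ ((Fin (suc lastSeg) × (Fin (suc maxOff) ⊎ ⊤)) ⊎ ⊤)
    f leftEnd = inj₁ tt
    f (inSeg j o) = inj₂ (inj₁ (j , o))
    f rightEnd = inj₂ (inj₂ tt)
    g : ⊤ ⊎ ((Fin (suc lastSeg) × (Fin (suc maxOff) ⊎ ⊤)) ⊎ ⊤) → Pos lastSeg maxOff
    g (inj₁ _) = leftEnd
    g (inj₂ (inj₁ (j , o))) = inSeg j o
    g (inj₂ (inj₂ _)) = rightEnd
    gf : ∀ b → g (f b) ≡ b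
    gf leftEnd = refl
    gf (inSeg j o) = refl
    gf rightEnd = refl

  coreE : FinEnc (Fin Q × Vec (Fin (suc G)) (suc maxCell) × Fin (suc maxCell) × Pos lastSeg maxOff)
  coreE = finE Q ×E (vecE (finE (suc G)) (suc maxCell) ×E (finE (suc maxCell) ×E posE))

-- The nondeterministic branching program: from the start state guess it
-- moves to run r core0 for any r ∈ [k], then simulates M on the instance
-- swapped at r, querying the variable under the input head; it outputs r
-- when M accepts.  By soundness of acceptance only the root value can be
-- output, and by completeness the run for r = root value reaches it.
module NondetBP (d n' k0 : ℕ) (M : TM) (c0 : ℕ) (decM : Decides M (BT d))
  (ls : ∀ w conf → Reachable M w conf → Config.wpos conf ≤ c0 * suc ⌊log₂ length w ⌋) where
  open Instance d n' k0
  open Segmented {V} {k}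
  open Decider M c0 decM ls
  open TM M
  open TransitionBound M
  open StateSpaces Q G maxCell lastSeg maxOff

  data NState : Set where
    guess : NState
    run : Fin k → Core → NState
    stuck : NState

  nstateE : FinEnc NState
  nstateE = retractE (⊤E ⊎E ((finE k ×E coreE) ⊎E ⊤E)) f g gf
    where
    f : NState → ⊤ ⊎ ((Fin k × Core) ⊎ ⊤)
    f guess = inj₁ tt
    f (run r σ) = inj₂ (inj₁ (r , σ))
    f stuck = inj₂ (inj₂ tt)
    g : ⊤ ⊎ ((Fin k × Core) ⊎ ⊤) → NState
    g (inj₁ _) = guess
    g (inj₂ (inj₁ (r , σ))) = run r σ
    g (inj₂ (inj₂ _)) = stuck
    gf : ∀ b → g (f b) ≡ b
    gf guess = refl
    gf (run r σ) = refl
    gf stuck = refl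

  acceptOut : Fin k → Core → List (NState ⊎ Fin k)
  acceptOut r (q , _) with q ≟ acc
  ... | yes _ = [ inj₂ r ]
  ... | no _ = []

  acceptOut≤ : ∀ r σ → length (acceptOut r σ) ≤ 1
  acceptOut≤ r (q , _) with q ≟ acc
  ... | yes _ = ≤-refl
  ... | no _ = z≤n

  runSteps : Fin k → Core → Fin k → List (NState ⊎ Fin k)
  runSteps r σ a = map (λ σ' → inj₁ (run r σ')) (coreNext σ (swapAtRoot r (coreVar σ) a))

  nstep : NState → Fin k → List (NState ⊎ Fin k)
  nstep guess a = map (λ r → inj₁ (run r core0)) (allFin k)
  nstep (run r σ) a = acceptOut r σ ++ runSteps r σ a
  nstep stuck a = [ inj₁ stuck ]

  nquery : NState → V
  nquery guess = someVar
  nquery (run r σ) = coreVar σ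
  nquery stuck = someVar

  -- the branching bound: k guesses, or an output and at most maxBranch steps
  nbranch : ℕ
  nbranch = k + suc maxBranch

  coreNext≤ : ∀ σ a → length (coreNext σ a) ≤ maxBranch
  coreNext≤ σ@(q , t , p , ps) a =
    ≤-trans (length-mapMaybe (applyTransition σ a) (δ q (posSymbol a ps) (lookup t p))) (δ≤maxBranch q (posSymbol a ps) (lookup t p))

  nstep≤ : ∀ σ a → length (nstep σ a) ≤ nbranch
  nstep≤ guess a = ≤-trans (≤-reflexive (trans (length-map _ (allFin k)) (len-allFin k))) (m≤m+n k _)
  nstep≤ (run r σ) a = ≤-trans (≤-reflexive (length-++ (acceptOut r σ)))
    (≤-trans (+-mono-≤ (acceptOut≤ r σ) runs≤) (m≤n+m _ k))
    where
    runs≤ : length (runSteps r σ a) ≤ maxBranch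
    runs≤ = ≤-trans (≤-reflexive (length-map _ (coreNext σ (swapAtRoot r (coreVar σ) a)))) (coreNext≤ σ _)
  nstep≤ stuck a = ≤-trans (s≤s z≤n) (m≤n+m _ k)

  open ProgramBP k nstateE nbranch nquery nstep stuck guess

  NInv : (V → Fin k) → NState → Set
  NInv x guess = ⊤
  NInv x stuck = ⊤
  NInv x (run r σ) = Σ (Config M) λ c → Reachable M (word segs (swapped r x)) c × Represents (swapped r x) c σ

  ninv-step : ∀ x {σ τ} → NInv x σ → SimStep x σ (inj₁ τ) → NInv x τ
  ninv-step x iv (inj₂ refl) = tt
  ninv-step x {guess} iv (inj₁ m) with ∈-map⁻ _ m
  ... | r , _ , refl = initial M , ε , represents-initial (swapped r x)
  ninv-step x {stuck} iv (inj₁ (here refl)) = tt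
  ninv-step x {run r σ} (c , rc , rl) (inj₁ m) with ∈-++⁻ (acceptOut r σ) m
  ... | inj₂ m2 with ∈-map⁻ _ m2
  ...   | σ' , m3 , refl with simulate-forward (swapped r x) c σ σ' rl m3
  ...     | c' , st , rl' = c' , rc ▷ st , rl'
  ninv-step x {run r (q , _)} (c , rc , rl) (inj₁ m) | inj₁ m1 with q ≟ acc
  ninv-step x {run r (q , _)} (c , rc , rl) (inj₁ m) | inj₁ (here ()) | yes _
  ninv-step x {run r (q , _)} (c , rc , rl) (inj₁ m) | inj₁ () | no _

  ninv-out : ∀ x {σ r} → NInv x σ → SimStep x σ (inj₂ r) → r ≡ eval d k n x
  ninv-out x iv (inj₂ ())
  ninv-out x {guess} iv (inj₁ m) with ∈-map⁻ _ m
  ... | r , _ , ()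
  ninv-out x {stuck} iv (inj₁ (here ()))
  ninv-out x {stuck} iv (inj₁ (there ()))
  ninv-out x {run r σ} (c , rc , rl) (inj₁ m) with ∈-++⁻ (acceptOut r σ) m
  ... | inj₂ m2 with ∈-map⁻ _ m2
  ...   | σ' , m3 , ()
  ninv-out x {run r (q , _)} (c , rc , rl) (inj₁ m) | inj₁ m1 with q ≟ acc
  ninv-out x {run r (q , _)} (c , rc , rl) (inj₁ m) | inj₁ (here refl) | yes qa =
    sym (accepts-sound r x (c , rc , trans (proj₁ rl) qa))
  ninv-out x {run r (q , _)} (c , rc , rl) (inj₁ m) | inj₁ () | no _

  lift-run : ∀ x r {σ σ'} → CoreStep (swapped r x) σ σ' → SStep x (run r σ) (run r σ')
  lift-run x r {σ} m = ∈-++⁺ʳ (acceptOut r σ) (∈-map⁺ (λ σ' → inj₁ (run r σ')) m)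

  ncomplete : ∀ x → Σ NState λ σ → Star (SStep x) guess σ × inj₂ (eval d k n x) ∈ nstep σ (x (nquery σ))
  ncomplete x with accepts-complete x
  ... | c , rc , st with reachable-core (swapped (eval d k n x) x) c rc
  ... | σ@(q , _) , path , rl = run (eval d k n x) σ ,
        (∈-map⁺ (λ r → inj₁ (run r core0)) (∈-allFin (eval d k n x)) ◅ gmap (run (eval d k n x)) (lift-run x _) path) , out
    where
    out : inj₂ (eval d k n x) ∈ acceptOut (eval d k n x) σ ++ runSteps (eval d k n x) σ (x (coreVar σ))
    out with q ≟ acc
    ... | yes _ = here refl
    ... | no ne = ⊥-elim (ne (trans (sym (proj₁ rl)) st))

  ninvariant : ∀ x → OutputInvariant x (eval d k n x)
  ninvariant x = record { Inv = NInv x ; inv-start = tt ; inv-step = ninv-step x ; inv-out = ninv-out x }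

  ndet-bp : NdetFStatesLe d (suc n) k (size nstateE + k)
  ndet-bp = bp , Completeness.computes nstep≤ (eval d k n) ncomplete ninvariant , ≤-refl



-- It tries the candidates r = 1, 2, …
-- in turn.  For each r it simulates the deterministic machine on the instance
-- swapped at r with a step counter below T; it outputs r when M accepts and
-- moves on to the next candidate when M halts or the counter runs out.  Only
-- the root value can be output, and it is: every run for a smaller candidate
-- fails, and the accepting core of the right run is reached in fewer than T
-- steps because T exceeds the number of values of Maybe Core.
module DetBP (d n' k0 : ℕ) (M : TM) (c0 : ℕ) (decM : Decides M (BT d))
  (ls : ∀ w conf → Reachable M w conf → Config.wpos conf ≤ c0 * suc ⌊log₂ length w ⌋)
  (isdet : IsDetTM M) where
  open Instance d n' k0
  open Segmented {V} {k}
  open Decider M c0 decM ls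
  open TM M
  open StateSpaces Q G maxCell lastSeg maxOff

  coreNext≤1 : ∀ σ a → length (coreNext σ a) ≤ 1
  coreNext≤1 σ@(q , t , p , ps) a =
    ≤-trans (length-mapMaybe (applyTransition σ a) (δ q (posSymbol a ps) (lookup t p))) (isdet q _ _)

  coreStep : Core → Fin k → Maybe Core
  coreStep σ a = headM (coreNext σ a)

  T : ℕ
  T = suc (size (maybeE coreE))

  data DState : Set where
    run : Fin k → Fin T → Core → DState
    stuck : DState

  dstateE : FinEnc DState
  dstateE = retractE ((finE k ×E (finE T ×E coreE)) ⊎E ⊤E) f g gf
    where
    f : DState → (Fin k × Fin T × Core) ⊎ ⊤
    f (run r t σ) = inj₁ (r , t , σ)
    f stuck = inj₂ tt
    g : (Fin k × Fin T × Core) ⊎ ⊤ → DState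
    g (inj₁ (r , t , σ)) = run r t σ
    g (inj₂ _) = stuck
    gf : ∀ b → g (f b) ≡ b
    gf (run r t σ) = refl
    gf stuck = refl

  firstCandidate : DState
  firstCandidate = run F.zero F.zero core0

  nextCandidate : Fin k → DState
  nextCandidate r with suc (toℕ r) <? k
  ... | yes p = run (fromℕ< p) F.zero core0
  ... | no _ = stuck

  continue : Fin k → Fin T → Maybe Core → DState
  continue r t nothing = nextCandidate r
  continue r t (just σ') with suc (toℕ t) <? T
  ... | yes p = run r (fromℕ< p) σ'
  ... | no _ = nextCandidate r

  dnext : DState → Fin k → DState ⊎ Fin k
  dnext (run r t σ) a with proj₁ σ ≟ acc
  ... | yes _ = inj₂ r
  ... | no _ = inj₁ (continue r t (coreStep σ (swapAtRoot r (coreVar σ) a)))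
  dnext stuck a = inj₁ stuck

  dquery : DState → V
  dquery (run r t σ) = coreVar σ
  dquery stuck = someVar

  open ProgramBP k dstateE 1 dquery (λ σ a → [ dnext σ a ]) stuck firstCandidate

  DInv : (V → Fin k) → DState → Set
  DInv x stuck = ⊤
  DInv x (run r t σ) = Σ (Config M) λ c → Reachable M (word segs (swapped r x)) c × Represents (swapped r x) c σ

  nextCandidate-inv : ∀ x r → DInv x (nextCandidate r)
  nextCandidate-inv x r with suc (toℕ r) <? k
  ... | yes p = initial M , ε , represents-initial (swapped (fromℕ< p) x)
  ... | no _ = tt

  continue-inv : ∀ x r t σ → DInv x (run r t σ) → ∀ m →
    (∀ {σ'} → m ≡ just σ' → CoreStep (swapped r x) σ σ') → DInv x (continue r t m)
  continue-inv x r t σ iv nothing _ = nextCandidate-inv x r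
  continue-inv x r t σ (c , rc , rl) (just σ') isStep with suc (toℕ t) <? T
  ... | no _ = nextCandidate-inv x r
  ... | yes _ with simulate-forward (swapped r x) c σ σ' rl (isStep refl)
  ...   | c' , st , rl' = c' , rc ▷ st , rl'

  dinv-step : ∀ x {σ τ} → DInv x σ → SimStep x σ (inj₁ τ) → DInv x τ
  dinv-step x iv (inj₂ refl) = tt
  dinv-step x iv (inj₁ (there ()))
  dinv-step x {stuck} iv (inj₁ (here refl)) = tt
  dinv-step x {run r t σ} iv (inj₁ (here eq)) with proj₁ σ ≟ acc
  dinv-step x {run r t σ} iv (inj₁ (here ())) | yes _
  dinv-step x {run r t σ} iv (inj₁ (here refl)) | no _ = continue-inv x r t σ iv _ (∈-headM _)

  dinv-out : ∀ x {σ r'} → DInv x σ → SimStep x σ (inj₂ r') → r' ≡ eval d k n x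
  dinv-out x iv (inj₂ ())
  dinv-out x iv (inj₁ (there ()))
  dinv-out x {stuck} iv (inj₁ (here ()))
  dinv-out x {run r t σ} (c , rc , rl) (inj₁ (here eq)) with proj₁ σ ≟ acc
  dinv-out x {run r t σ} (c , rc , rl) (inj₁ (here refl)) | yes qa = sym (accepts-sound r x (c , rc , trans (proj₁ rl) qa))
  dinv-out x {run r t σ} (c , rc , rl) (inj₁ (here ())) | no _

  dinvariant : ∀ x → OutputInvariant x (eval d k n x)
  dinvariant x = record { Inv = DInv x ; inv-start = initial M , ε , represents-initial (swapped F.zero x)
                        ; inv-step = dinv-step x ; inv-out = dinv-out x }

  accepting-out : ∀ (x : V → Fin k) r t σ → proj₁ σ ≡ acc → inj₂ r ∈ [ dnext (run r t σ) (x (coreVar σ)) ]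
  accepting-out x r t σ qa with proj₁ σ ≟ acc
  ... | yes _ = here refl
  ... | no na = ⊥-elim (na qa)

  rejecting-step : ∀ (x : V → Fin k) r t σ → ¬ proj₁ σ ≡ acc →
    SStep x (run r t σ) (continue r t (coreStep σ (swapped r x (coreVar σ))))
  rejecting-step x r t σ na with proj₁ σ ≟ acc
  ... | yes qa = ⊥-elim (na qa)
  ... | no _ = here refl

  module Candidate (x : V → Fin k) (r : Fin k) where
    y : V → Fin k
    y = swapped r x

    nextCore : Core → Maybe Core
    nextCore σ = coreStep σ (y (coreVar σ))

    open Iteration nextCore public

    continue-just : ∀ t σ' (p : suc (toℕ t) < T) → continue r t (just σ') ≡ run r (fromℕ< p) σ'
    continue-just t σ' p with suc (toℕ t) <? T
    ... | yes _ = refl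
    ... | no np = ⊥-elim (np p)

    fails : ¬ eval d k n x ≡ r → ∀ fuel t σ c → T ≤ toℕ t + fuel →
      Reachable M (word segs y) c → Represents y c σ → Star (SStep x) (run r t σ) (nextCandidate r)
    fails wrong zero t σ c budget rc rl = ⊥-elim (<⇒≱ (toℕ<n t) (subst (T ≤_) (+-identityʳ _) budget))
    fails wrong (suc fuel) t σ c budget rc rl with proj₁ σ ≟ acc
    ... | yes qa = ⊥-elim (wrong (accepts-sound r x (c , rc , trans (proj₁ rl) qa)))
    ... | no na = rejecting-step x r t σ na ◅ after (nextCore σ) (∈-headM _)
      where
      after : ∀ m → (∀ {σ'} → m ≡ just σ' → CoreStep y σ σ') → Star (SStep x) (continue r t m) (nextCandidate r)
      after nothing _ = ε
      after (just σ') isStep with suc (toℕ t) <? T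
      ... | no _ = ε
      ... | yes p with simulate-forward y c σ σ' rl (isStep refl)
      ...   | c' , st , rl' = fails wrong fuel (fromℕ< p) σ' c' budget′ (rc ▷ st) rl'
        where
        budget′ : T ≤ toℕ (fromℕ< p) + fuel
        budget′ = subst (λ z → T ≤ z + fuel) (sym (toℕ-fromℕ< p)) (subst (T ≤_) (+-suc _ fuel) budget)

    Outputs : Set
    Outputs = Σ DState λ τ → Star (SStep x) (run r F.zero core0) τ × inj₂ r ∈ [ dnext τ (x (dquery τ)) ]

    follows : ∀ N σa → N < T → iterate core0 N ≡ just σa → ∀ t → t ≤ N →
      Outputs ⊎ Σ (Fin T) λ tf → Σ Core λ σ → toℕ tf ≡ t × iterate core0 t ≡ just σ
                                × Star (SStep x) (run r F.zero core0) (run r tf σ)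
    follows N σa N<T eN zero _ = inj₂ (F.zero , core0 , refl , refl , ε)
    follows N σa N<T eN (suc t) le with follows N σa N<T eN t (≤-trans (n≤1+n t) le)
    ... | inj₁ o = inj₁ o
    ... | inj₂ (tf , σ , et , it , path) with proj₁ σ ≟ acc
    ...   | yes qa = inj₁ (run r tf σ , path , accepting-out x r tf σ qa)
    ...   | no na with nextCore σ in eS
    ...     | nothing = ⊥-elim (just≢nothing (trans (sym eN)
                 (trans (cong (iterate core0) (sym (m+[n∸m]≡n le))) (iterate-nothing core0 (suc t) (N ∸ suc t) stops))))
      where
      stops : iterate core0 (suc t) ≡ nothing
      stops = trans (iterate-suc core0 t) (trans (cong (_>>= nextCore) it) eS)
      just≢nothing : ∀ {c : Core} → just c ≡ nothing → ⊥
      just≢nothing ()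
    ...     | just σ' = inj₂ (fromℕ< p , σ' , trans (toℕ-fromℕ< p) (cong suc et) ,
                 trans (iterate-suc core0 t) (trans (cong (_>>= nextCore) it) eS) ,
                 path ▷ subst (SStep x (run r tf σ)) (trans (cong (continue r tf) eS) (continue-just tf σ' p))
                              (rejecting-step x r tf σ na))
      where
      p : suc (toℕ tf) < T
      p = subst (λ z → suc z < T) (sym et) (<-≤-trans (s≤s le) N<T)

    succeeds : ∀ N σa → N < T → iterate core0 N ≡ just σa → proj₁ σa ≡ acc → Outputs
    succeeds N σa N<T eN qa with follows N σa N<T eN N ≤-refl
    ... | inj₁ o = o
    ... | inj₂ (tf , σ , _ , it , path) with trans (sym it) eN
    ...   | refl = run r tf σ , path , accepting-out x r tf σ qa

  candidatesBelow : ∀ x m (m<k : m < k) → m ≤ toℕ (eval d k n x) →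
    Star (SStep x) firstCandidate (run (fromℕ< m<k) F.zero core0)
  candidatesBelow x zero _ _ = ε
  candidatesBelow x (suc m) sm<k le =
    candidatesBelow x m m<k (≤-trans (n≤1+n m) le) ◅◅
    subst (Star (SStep x) (run r F.zero core0)) next≡
      (Candidate.fails x r wrong T F.zero core0 (initial M) (m≤n+m T 0) ε (represents-initial (swapped r x)))
    where
    m<k : m < k
    m<k = <-trans (n<1+n m) sm<k
    r : Fin k
    r = fromℕ< m<k
    wrong : ¬ eval d k n x ≡ r
    wrong e = <⇒≢ (subst (_≤ toℕ (eval d k n x)) (cong suc (sym (toℕ-fromℕ< m<k))) le) (sym (cong toℕ e))
    next≡ : nextCandidate r ≡ run (fromℕ< sm<k) F.zero core0
    next≡ with suc (toℕ r) <? k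
    ... | yes p = cong (λ z → run z F.zero core0)
                    (toℕ-injective (trans (toℕ-fromℕ< p) (trans (cong suc (toℕ-fromℕ< m<k)) (sym (toℕ-fromℕ< sm<k)))))
    ... | no np = ⊥-elim (np (subst (λ z → suc z < k) (sym (toℕ-fromℕ< m<k)) sm<k))

  dcomplete : ∀ x → Σ DState λ σ → Star (SStep x) firstCandidate σ × inj₂ (eval d k n x) ∈ [ dnext σ (x (dquery σ)) ]
  dcomplete x with accepts-complete x
  ... | c , rc , accepting with reachable-core (swapped (eval d k n x) x) c rc
  ... | σa , corePath , rl with Candidate.path-iterate x (eval d k n x) (headM-∈ _ (coreNext≤1 _ _)) corePath
  ... | N , eN with Candidate.shorten x (eval d k n x) (maybeE coreE) core0 N eN
  ... | N' , N'<T , eN' with Candidate.succeeds x (eval d k n x) N' σa N'<T eN' (trans (sym (proj₁ rl)) accepting)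
  ... | τ , path , out =
    τ , subst (λ z → Star (SStep x) firstCandidate (run z F.zero core0)) (fromℕ<-toℕ r₀ (toℕ<n r₀))
              (candidatesBelow x (toℕ r₀) (toℕ<n r₀) ≤-refl) ◅◅ path , out
    where
    r₀ : Fin k
    r₀ = eval d k n x

  det-bp : DetFStatesLe d (suc n) k (size dstateE + k)
  det-bp = bp , deterministic refl , Completeness.computes (λ _ _ → ≤-refl) (eval d k n) dcomplete dinvariant , ≤-refl

-- Polynomial bounds.  Bd k a e X states X ≤ a·k^e; as a record its indices
-- are inferred, so bounds compose along the structure of the state sets.
record Bd (k a e X : ℕ) : Set where
  constructor bd
  field bound : X ≤ a * k ^ e
open Bd

^-distribʳ-* : ∀ u v m → (u * v) ^ m ≡ u ^ m * v ^ m
^-distribʳ-* u v zero = refl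
^-distribʳ-* u v (suc m) = trans (cong ((u * v) *_) (^-distribʳ-* u v m)) (lem u v (u ^ m) (v ^ m))
  where
  lem : ∀ a b u v → (a * b) * (u * v) ≡ (a * u) * (b * v)
  lem = solve-∀

module PolyBound (k0 : ℕ) where
  k : ℕ
  k = suc k0

  bweak : ∀ {a e X Y} → X ≤ Y → Bd k a e Y → Bd k a e X
  bweak X≤Y (bd b) = bd (≤-trans X≤Y b)

  bconst : ∀ a → Bd k a 0 a
  bconst a = bd (≤-reflexive (sym (*-identityʳ a)))

  bk : Bd k 1 1 k
  bk = bd (≤-reflexive (sym (trans (+-identityʳ (k * 1)) (*-identityʳ k))))

  bmul : ∀ {a b e f X Y} → Bd k a e X → Bd k b f Y → Bd k (a * b) (e + f) (X * Y)
  bmul {a} {b} {e} {f} (bd bx) (bd by) = bd (≤-trans (*-mono-≤ bx by)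
    (≤-reflexive (trans (lem a b (k ^ e) (k ^ f)) (cong (a * b *_) (sym (^-distribˡ-+-* k e f))))))
    where
    lem : ∀ a b u v → (a * u) * (b * v) ≡ (a * b) * (u * v)
    lem = solve-∀

  badd : ∀ {a b e f X Y} → Bd k a e X → Bd k b f Y → Bd k (a + b) (e + f) (X + Y)
  badd {a} {b} {e} {f} (bd bx) (bd by) = bd (≤-trans
    (+-mono-≤ (≤-trans bx (*-monoʳ-≤ a (^-monoʳ-≤ k (m≤m+n e f)))) (≤-trans by (*-monoʳ-≤ b (^-monoʳ-≤ k (m≤n+m f e)))))
    (≤-reflexive (sym (*-distribʳ-+ (k ^ (e + f)) a b))))

  bpow : ∀ {a e X} → Bd k a e X → ∀ m → Bd k (a ^ m) (e * m) (X ^ m)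
  bpow {a} {e} (bd bx) m = bd (≤-trans (^-monoˡ-≤ m bx)
    (≤-reflexive (trans (^-distribʳ-* a (k ^ e) m) (cong (a ^ m *_) (^-*-assoc k e m)))))

2^log₂≤ : ∀ n (ac : Acc _<_ n) → 1 ≤ n → 2 ^ ⌊log2⌋ n ac ≤ n
2^log₂≤ (suc zero) ac _ = s≤s z≤n
2^log₂≤ (suc (suc m)) (WF.acc rs) _ = ≤-trans (*-monoʳ-≤ 2 (2^log₂≤ (suc ⌊ m /2⌋) _ (s≤s z≤n))) (double-half m)
  where
  double-half : ∀ m → 2 * suc ⌊ m /2⌋ ≤ suc (suc m)
  double-half zero = s≤s (s≤s z≤n)
  double-half (suc zero) = s≤s (s≤s z≤n)
  double-half (suc (suc m)) = ≤-trans (≤-reflexive (lem ⌊ m /2⌋)) (s≤s (s≤s (double-half m)))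
    where
    lem : ∀ x → 2 * suc (suc x) ≡ suc (suc (2 * suc x))
    lem = solve-∀

-- Logarithmic space gives polynomially many tape contents: with b ≤ 2^g
-- symbols, b^(1 + c0·(1 + log₂ L)) ≤ 2^(g + g·c0) · L^(g·c0).
log-bound : ∀ b g c0 L → 1 ≤ L → b ≤ 2 ^ g →
  b ^ suc (c0 * suc ⌊log₂ L ⌋) ≤ 2 ^ (g + g * c0) * L ^ (g * c0)
log-bound b g c0 L L≥1 b≤2^g = begin
  b ^ suc (c0 * suc lg)                       ≤⟨ ^-monoˡ-≤ (suc (c0 * suc lg)) b≤2^g ⟩
  (2 ^ g) ^ suc (c0 * suc lg)                 ≡⟨ ^-*-assoc 2 g _ ⟩
  2 ^ (g * suc (c0 * suc lg))                 ≡⟨ cong (2 ^_) (exponent g c0 lg) ⟩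
  2 ^ ((g + g * c0) + lg * (g * c0))          ≡⟨ ^-distribˡ-+-* 2 (g + g * c0) (lg * (g * c0)) ⟩
  2 ^ (g + g * c0) * 2 ^ (lg * (g * c0))      ≡⟨ cong (2 ^ (g + g * c0) *_) (sym (^-*-assoc 2 lg (g * c0))) ⟩
  2 ^ (g + g * c0) * (2 ^ lg) ^ (g * c0)      ≤⟨ *-monoʳ-≤ (2 ^ (g + g * c0)) (^-monoˡ-≤ (g * c0) (2^log₂≤ L _ L≥1)) ⟩
  2 ^ (g + g * c0) * L ^ (g * c0)             ∎
  where
  open ≤-Reasoning
  lg : ℕ
  lg = ⌊log₂ L ⌋
  exponent : ∀ g c0 lg → g * suc (c0 * suc lg) ≡ (g + g * c0) + lg * (g * c0)
  exponent = solve-∀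

n≤2^n : ∀ n → n ≤ 2 ^ n
n≤2^n zero = z≤n
n≤2^n (suc n) = begin
  suc n           ≤⟨ s≤s (n≤2^n n) ⟩
  1 + 2 ^ n       ≤⟨ +-monoˡ-≤ (2 ^ n) (m^n>0 2 n) ⟩
  2 ^ n + 2 ^ n   ≡⟨ cong (2 ^ n +_) (sym (+-identityʳ (2 ^ n))) ⟩
  2 * 2 ^ n       ∎
  where open ≤-Reasoning

-- Following the structure of the state sets we obtain
-- coefficients a… depending only on n = h - 1 and exponents e… depending on
-- neither n nor k (only on d, on the number G+1 of work symbols and on the
-- space constant c0 of M).
module StateCount (d : ℕ) (M : TM) (c0 : ℕ) (decM : Decides M (BT d))
  (ls : ∀ w conf → Reachable M w conf → Config.wpos conf ≤ c0 * suc ⌊log₂ length w ⌋) where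
  open TM M using (Q; G)
  g : ℕ
  g = suc G
  gc : ℕ
  gc = g * c0

  aS aB aL aV aP aC : ℕ → ℕ
  aS n = 1 + varBound d n
  aB n = (2 * suc n + 2 + 3) + 2 * 1
  aL n = aS n * aB n
  aV n = 2 ^ (g + gc) * aL n ^ gc
  aP n = 1 + ((aS n * (aB n + 1)) + 1)
  aC n = Q * (aV n * (aV n * aP n))

  eL eV eP eC : ℕ
  eL = d + 1
  eV = eL * gc
  eP = (d + 1) + 0
  eC = eV + (eV + eP)

  aND aD : ℕ → ℕ
  aND n = (1 + ((1 * aC n) + 1)) + 1
  aD n = ((1 * ((1 + (1 + aC n)) * aC n)) + 1) + 1

  eND eD : ℕ
  eND = ((1 + eC) + 0) + 1
  eD = ((1 + (eC + eC)) + 0) + 1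

  module _ (n' k0 : ℕ) where
    open Instance d n' k0
    open Decider M c0 decM ls
    open PolyBound k0 hiding (k)
    open StateSpaces Q G maxCell lastSeg maxOff

    bS : Bd k (aS n) d (suc lastSeg)
    bS = badd (bconst 1) (subst (Bd k (varBound d n) d) (sym lastSeg≡) (bd (len-enum d k0 n)))

    bB : Bd k (aB n) 1 (suc maxOff)
    bB = bweak (≤-reflexive (trans (cong suc maxOff≡) (lem (2 * suc n) k)))
               (badd (bconst (2 * suc n + 2 + 3)) (bmul (bconst 2) bk))
      where
      lem : ∀ a k → suc (a + 2 + (2 * k + 2)) ≡ (a + 2 + 3) + 2 * k
      lem = solve-∀

    bL : Bd k (aL n) eL maxLen
    bL = subst (Bd k (aL n) eL) (sym maxLen≡) (bmul bS bB)

    maxLen≥1 : 1 ≤ maxLen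
    maxLen≥1 = subst (1 ≤_) (sym maxLen≡) (*-mono-≤ {1} {suc lastSeg} {1} {suc maxOff} (s≤s z≤n) (s≤s z≤n))

    bTape : ∀ b → b ≤ 2 ^ g → Bd k (aV n) eV (b ^ suc maxCell)
    bTape b b≤ =
      bweak (subst (λ z → b ^ suc z ≤ 2 ^ (g + gc) * maxLen ^ gc) (sym maxCell≡) (log-bound b g c0 maxLen maxLen≥1 b≤))
            (bmul (bconst (2 ^ (g + gc))) (bpow bL gc))

    bV : Bd k (aV n) eV (size (vecE (finE (suc G)) (suc maxCell)))
    bV = subst (Bd k (aV n) eV) (sym (size-vecE (finE (suc G)) (suc maxCell))) (bTape (suc G) (n≤2^n (suc G)))

    bW : Bd k (aV n) eV (suc maxCell)
    bW = bweak (n≤2^n (suc maxCell)) (bTape 2 (*-monoʳ-≤ 2 (m^n>0 2 G)))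

    bP : Bd k (aP n) eP (size posE)
    bP = badd (bconst 1) (badd (bmul bS (badd bB (bconst 1))) (bconst 1))

    bC : Bd k (aC n) eC (size coreE)
    bC = bmul (bconst Q) (bmul bV (bmul bW bP))

    -- the nondeterministic program: guess, k·(core) run states, stuck, k outputs
    bND : Bd k (aND n) eND (size (NondetBP.nstateE d n' k0 M c0 decM ls) + k)
    bND = badd (badd (bconst 1) (badd (bmul bk bC) (bconst 1))) bk

    ndet-bound : NdetFStatesLe d (suc n) k (aND n * k ^ eND)
    ndet-bound = let (P , computes , size≤) = NondetBP.ndet-bp d n' k0 M c0 decM ls in
      P , computes , ≤-trans size≤ (bound bND)

    -- the deterministic program: k·T·(core) run states, stuck, k outputs
    module _ (isdet : IsDetTM M) where
      open DetBP d n' k0 M c0 decM ls isdet using (T; dstateE; det-bp)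

      bT : Bd k (1 + (1 + aC n)) eC T
      bT = badd (bconst 1) (badd (bconst 1) bC)

      bD : Bd k (aD n) eD (size dstateE + k)
      bD = badd (badd (bmul bk (bmul bT bC)) (bconst 1)) bk

      det-bound : DetFStatesLe d (suc n) k (aD n * k ^ eD)
      det-bound = let (P , det , computes , size≤) = det-bp in
        P , det , computes , ≤-trans size≤ (bound bD)

-- The bound holds for all h ≥ 2 and
-- k ≥ 1.
theorem3p2 : (d : ℕ) → 2 ≤ d →
    (InL (BT d) → Σ ℕ λ c → Σ (ℕ → ℕ) λ f →
    ∀ h k → 2 ≤ h → 2 ≤ k → DetFStatesLe d h k (f h * k ^ c))
    × (InNL (BT d) → Σ ℕ λ c → Σ (ℕ → ℕ) λ f →
    ∀ h k → 2 ≤ h → 2 ≤ k → NdetFStatesLe d h k (f h * k ^ c))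
theorem3p2 d _ = deterministic-case , nondeterministic-case
  where
  deterministic-case : InL (BT d) → Σ ℕ λ c → Σ (ℕ → ℕ) λ f →
    ∀ h k → 2 ≤ h → 2 ≤ k → DetFStatesLe d h k (f h * k ^ c)
  deterministic-case (M , isdet , (c0 , ls) , decM) = eD , (λ h → aD (pred h)) , bound-for
    where
    open StateCount d M c0 decM ls
    bound-for : ∀ h k → 2 ≤ h → 2 ≤ k → DetFStatesLe d h k (aD (pred h) * k ^ eD)
    bound-for (suc (suc n')) (suc k0) (s≤s (s≤s _)) _ = det-bound n' k0 isdet

  nondeterministic-case : InNL (BT d) → Σ ℕ λ c → Σ (ℕ → ℕ) λ f →
    ∀ h k → 2 ≤ h → 2 ≤ k → NdetFStatesLe d h k (f h * k ^ c)
  nondeterministic-case (M , (c0 , ls) , decM) = eND , (λ h → aND (pred h)) , bound-for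
    where
    open StateCount d M c0 decM ls
    bound-for : ∀ h k → 2 ≤ h → 2 ≤ k → NdetFStatesLe d h k (aND (pred h) * k ^ eND)
    bound-for (suc (suc n')) (suc k0) (s≤s (s≤s _)) _ = ndet-bound n' k0
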